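{- For all integers $1\leq k\leq n$, \[ S_{n,k}=\sum_{r=k-1}^{n-1}(-1)^{n-1-r}\binom{2n-2-r}{k-1}X_1^{r}\,\widetilde{B}_{2n-1-k-r,\;n-1-r}. \]
   Context: Let $R=\mathbb{Z}[X_1,X_1^{ -1},X_2,X_3,\ldots]$ (Laurent in $X_1$, polynomial in the other indeterminates). Partial exponential Bell polynomials: $B_{0,0}=1$, $B_{n,0}=0$ for $n\geq1$, $B_{n,k}=0$ for $0\leq n<k$, and for $1\leq k\leq n$ \[B_{n,k}=\sum \frac{n!}{r_1!r_2!\cdots r_{n-k+1}!\,(1!)^{r_1}(2!)^{r_2}\cdots((n-k+1)!)^{r_{n-k+1}}}X_1^{r_1}X_2^{r_2}\cdots X_{n-k+1}^{r_{n-k+1}},\] the sum over all nonnegative integers $r_1,\ldots,r_{n-k+1}$ with $\sum_i r_i=k$ and $\sum_i i\,r_i=n$. The associated Bell polynomial $\widetilde{B}_{n,k}$ is $B_{n,k}$ with $X_1$ replaced by $0$. Elements $S_{n,k}\in R$ ($n,k\geq0$; multivariate Stirling polynomials of the first kind) are defined by $S_{0,0}=X_1^{ -1}$, $S_{n,0}=0$ for $n\geq1$, $S_{n,k}=0$ for $0\leq n<k$, and for $n\geq0$, $1\leq k\leq n+1$: \[S_{n+1,k}=-(2n-1)X_2S_{n,k}+X_1\Big(S_{n,k-1}+\sum_{j=1}^{n-k+1}X_{j+1}\frac{\partial S_{n,k}}{\partial X_j}\Big).\] -}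

module Defs where

open import Data.Bool using (Bool; true; false; _∧_; if_then_else_)
open import Data.Nat as ℕ using (ℕ; zero; suc; _≡ᵇ_; _<ᵇ_; _∸_)
open import Data.Nat.DivMod using (_/_)
open import Data.Nat.Combinatorics using (_C_)
open import Data.Nat using (_!)
open import Data.Integer as ℤ using (ℤ; +_; -[1+_])
open import Data.List using (List; []; _∷_; map; foldr; _++_; concatMap; filterᵇ; upTo; replicate; cartesianProductWith)
open import Data.Product using (_×_; _,_; proj₁; proj₂)
open import Relation.Nullary.Decidable using (does)
open import Relation.Binary.PropositionalEquality using (_≡_)

-- The ring R = ℤ[X₁, X₁⁻¹, X₂, X₃, …]
--
-- A monomial X₁^e · X₂^{a₀} · X₃^{a₁} ⋯ is represented by (e , a₀ ∷ a₁ ∷ …),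
-- with e ∈ ℤ (Laurent in X₁) and the list read up to trailing zeros.
-- A polynomial is a finite formal sum (list) of coefficient–monomial terms;
-- two polynomials are equal in R iff all their coefficients agree (_≈_).

Mono : Set
Mono = ℤ × List ℕ

Poly : Set
Poly = List (ℤ × Mono)

eqExp : List ℕ → List ℕ → Bool
eqExp []       []       = true
eqExp []       (y ∷ ys) = (y ≡ᵇ 0) ∧ eqExp [] ys
eqExp (x ∷ xs) []       = (x ≡ᵇ 0) ∧ eqExp xs []
eqExp (x ∷ xs) (y ∷ ys) = (x ≡ᵇ y) ∧ eqExp xs ys

eqMono : Mono → Mono → Bool
eqMono (e , xs) (f , ys) = does (e ℤ.≟ f) ∧ eqExp xs ys

sumℤ : List ℤ → ℤ
sumℤ = foldr ℤ._+_ (+ 0)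

coeff : Poly → Mono → ℤ
coeff p m = sumℤ (map proj₁ (filterᵇ (λ t → eqMono (proj₂ t) m) p))

infix 4 _≈_
_≈_ : Poly → Poly → Set
p ≈ q = ∀ m → coeff p m ≡ coeff q m

0P : Poly
0P = []

const : ℤ → Poly
const c = (c , (+ 0 , [])) ∷ []

1P : Poly
1P = const (+ 1)

infixl 6 _+P_
_+P_ : Poly → Poly → Poly
p +P q = p ++ q

scale : ℤ → Poly → Poly
scale c = map (λ { (d , m) → (c ℤ.* d , m) })

addExp : List ℕ → List ℕ → List ℕ
addExp []       ys       = ys
addExp (x ∷ xs) []       = x ∷ xs
addExp (x ∷ xs) (y ∷ ys) = (x ℕ.+ y) ∷ addExp xs ys

mulMono : Mono → Mono → Mono
mulMono (e , xs) (f , ys) = (e ℤ.+ f , addExp xs ys)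

infixl 7 _*P_
_*P_ : Poly → Poly → Poly
p *P q = cartesianProductWith (λ { (c , m) (d , n) → (c ℤ.* d , mulMono m n) }) p q

sumP : List Poly → Poly
sumP = foldr _+P_ 0P

X₁⁻¹ : Poly
X₁⁻¹ = (+ 1 , (-[1+ 0 ] , [])) ∷ []

-- X i  is the indeterminate X_i for i ≥ 1 (X 0 is unused and set to 0)
X : ℕ → Poly
X zero                = 0P
X (suc zero)          = (+ 1 , (+ 1 , [])) ∷ []
X (suc (suc i))       = (+ 1 , (+ 0 , replicate i 0 ++ (1 ∷ []))) ∷ []

X₁^ : ℕ → Poly
X₁^ r = (+ 1 , (+ r , [])) ∷ []

dExp : ℕ → List ℕ → ℕ × List ℕ
dExp i       []       = (0 , [])
dExp zero    (x ∷ xs) = (x , (x ∸ 1) ∷ xs)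
dExp (suc i) (x ∷ xs) with dExp i xs
... | (a , ys) = (a , x ∷ ys)

-- ∂ j = ∂/∂X_j for j ≥ 1 (∂ 0 is unused and gives 0)
∂ : ℕ → Poly → Poly
∂ zero          p = 0P
∂ (suc zero)    p = map (λ { (c , (e , xs)) → (c ℤ.* e , (e ℤ.- + 1 , xs)) }) p
∂ (suc (suc i)) p = map (λ { (c , (e , xs)) → let r = dExp i xs in (c ℤ.* + proj₁ r , (e , proj₂ r)) }) p

tuples : ℕ → ℕ → List (List ℕ)
tuples zero      b = [] ∷ []
tuples (suc len) b = concatMap (λ r → map (r ∷_) (tuples len b)) (upTo (suc b))

sumℕ : List ℕ → ℕ
sumℕ = foldr ℕ._+_ 0

weighted : ℕ → List ℕ → ℕ
weighted i []       = 0
weighted i (r ∷ rs) = i ℕ.* r ℕ.+ weighted (suc i) rs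

denom : ℕ → List ℕ → ℕ
denom i []       = 1
denom i (r ∷ rs) = (r !) ℕ.* ((i !) ℕ.^ r) ℕ.* denom (suc i) rs

-- exact natural division (the divisor is never 0 in use)
_div_ : ℕ → ℕ → ℕ
m div zero    = 0
m div (suc d) = m / suc d

monoOf : List ℕ → Mono
monoOf []       = (+ 0 , [])
monoOf (r ∷ rs) = (+ r , rs)

bellSum : ℕ → ℕ → Poly
bellSum n k =
  map (λ rs → (+ ((n !) div denom 1 rs) , monoOf rs))
      (filterᵇ (λ rs → (sumℕ rs ≡ᵇ k) ∧ (weighted 1 rs ≡ᵇ n))
               (tuples (suc (n ∸ k)) k))

B : ℕ → ℕ → Poly
B zero    zero    = 1P
B (suc n) zero    = 0P
B n       (suc k) = if n <ᵇ suc k then 0P else bellSum n (suc k)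

-- X₁ ↦ 0 (on polynomials in X₁): keep exactly the terms free of X₁
killX₁ : Poly → Poly
killX₁ = filterᵇ (λ { (c , (e , xs)) → does (e ℤ.≟ + 0) })

B̃ : ℕ → ℕ → Poly
B̃ n k = killX₁ (B n k)

S : ℕ → ℕ → Poly
S zero    zero    = X₁⁻¹
S zero    (suc k) = 0P
S (suc n) zero    = 0P
S (suc n) (suc k) =
  if suc n <ᵇ suc k then 0P else
    (scale (ℤ.- ((+ (2 ℕ.* n)) ℤ.- + 1)) (X 2 *P S n (suc k))
     +P X 1 *P (S n k
                +P sumP (map (λ i → X (suc (suc i)) *P ∂ (suc i) (S n (suc k)))
                             (upTo (suc n ∸ suc k)))))

rhs : ℕ → ℕ → Poly
rhs n k = sumP (map term (map (λ i → (k ∸ 1) ℕ.+ i) (upTo (n ∸ (k ∸ 1)))))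
  where
  term : ℕ → Poly
  term r = scale (((ℤ.- + 1) ℤ.^ (n ∸ 1 ∸ r)) ℤ.* + ((2 ℕ.* n ∸ 2 ∸ r) C (k ∸ 1)))
                 (X₁^ r *P B̃ (2 ℕ.* n ∸ 1 ∸ k ∸ r) (n ∸ 1 ∸ r))

module Submission where

-- Both sides of the identity are compared coefficientwise.
-- A monomial of R is X₁^e · X₂^{y₀} X₃^{y₁} ⋯ with e ∈ ℤ and an exponent list ys;
-- write K = Σ yⱼ (its size) and N = Σ (j+2) yⱼ (its weight).  We show that for
-- n ≥ 1 the coefficient of this monomial in S n (k+1) is given by the closed form
--
--     (-1)^K · C(n-1+K, k) · β(ys)      if  e = n-1-K  and  k+1+N = n+K,
--     0                                  otherwise,
--
-- where β(ys) = N! / ∏ yⱼ! ((j+2)!)^{yⱼ} is the coefficient of X^ys in B̃ N K.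
-- By induction on n the coefficients of S n k equal the closed form, and the
-- theorem follows by comparing with the right-hand side.

open import Defs
open import Data.Bool using (Bool; true; false; _∧_; if_then_else_; T)
open import Data.Nat as ℕ using (ℕ; zero; suc; _≡ᵇ_; _<ᵇ_; _∸_; _+_; _*_; _^_; _≤_; _<_; z≤n; s≤s; _!)
open import Data.Nat.Properties as ℕₚ using (≡ᵇ⇒≡)
open import Data.Nat.Combinatorics using (_C_; nCk≡n!/k![n-k]!; k>n⇒nCk≡0; k![n∸k]!∣n!; nCk+nC[k+1]≡[n+1]C[k+1]; nCn≡1)
open import Data.Nat.DivMod using (m*[n/m]≡n; m*n/n≡m; n/1≡n)
open import Data.Integer as ℤ using (ℤ; +_; -[1+_])
open import Data.Integer.Properties as ℤₚ using ()
open import Data.List using (List; []; _∷_; map; _++_; concat; concatMap; filterᵇ; upTo; applyUpTo; replicate; length)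
open import Data.List.Properties as Listₚ using ()
open import Data.Product using (_×_; _,_; proj₁; proj₂; Σ)
open import Relation.Nullary using (¬_)
open import Relation.Nullary.Decidable using (does; yes; no; dec-true)
open import Relation.Binary.PropositionalEquality
open import Data.Empty using (⊥; ⊥-elim)
open import Data.Unit using (tt)
open import Function using (_∘_)
open import Data.Integer.Tactic.RingSolver using () renaming (solve-∀ to ℤ-solve)
open import Data.Nat.Tactic.RingSolver using () renaming (solve-∀ to ℕ-solve)

false≢true : false ≡ true → ⊥
false≢true ()

∧-true₁ : ∀ {a b} → a ∧ b ≡ true → a ≡ true
∧-true₁ {true} e = refl

∧-true₂ : ∀ {a b} → a ∧ b ≡ true → b ≡ true
∧-true₂ {true} e = e

∧-intro : ∀ {a b} → a ≡ true → b ≡ true → a ∧ b ≡ true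
∧-intro refl refl = refl

bool-ext : ∀ {a b : Bool} → (a ≡ true → b ≡ true) → (b ≡ true → a ≡ true) → a ≡ b
bool-ext {true}  {true}  f g = refl
bool-ext {true}  {false} f g = ⊥-elim (false≢true (f refl))
bool-ext {false} {true}  f g = ⊥-elim (false≢true (g refl))
bool-ext {false} {false} f g = refl

not-true : ∀ {b : Bool} → ¬ (b ≡ true) → b ≡ false
not-true {true}  h = ⊥-elim (h refl)
not-true {false} h = refl

if-true : ∀ {A : Set} {b : Bool} {x y : A} → b ≡ true → (if b then x else y) ≡ x
if-true refl = refl

if-false : ∀ {A : Set} {b : Bool} {x y : A} → b ≡ false → (if b then x else y) ≡ y
if-false refl = refl

ᵇ⇒ : ∀ x y → (x ≡ᵇ y) ≡ true → x ≡ y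
ᵇ⇒ x y e = ≡ᵇ⇒≡ x y (subst T (sym e) tt)

⇒ᵇ : ∀ x y → x ≡ y → (x ≡ᵇ y) ≡ true
⇒ᵇ zero    zero    e = refl
⇒ᵇ (suc x) (suc y) e = ⇒ᵇ x y (ℕₚ.suc-injective e)

<ᵇ⇒ : ∀ {m n} → (m <ᵇ n) ≡ true → m < n
<ᵇ⇒ {m} {n} e = ℕₚ.<ᵇ⇒< m n (subst T (sym e) tt)

⇒<ᵇ : ∀ {m n} → m < n → (m <ᵇ n) ≡ true
⇒<ᵇ {zero}  {suc n} p       = refl
⇒<ᵇ {suc m} {suc n} (s≤s p) = ⇒<ᵇ p

≤⇒<ᵇ-false : ∀ {m n} → n ≤ m → (m <ᵇ n) ≡ false
≤⇒<ᵇ-false h = not-true (λ e → ℕₚ.<⇒≱ (<ᵇ⇒ e) h)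

ℤ≟-sound : ∀ e f → does (e ℤ.≟ f) ≡ true → e ≡ f
ℤ≟-sound e f h with e ℤ.≟ f
... | yes p = p
... | no _  = ⊥-elim (false≢true h)

ℤ≟-complete : ∀ e f → e ≡ f → does (e ℤ.≟ f) ≡ true
ℤ≟-complete e f = dec-true (e ℤ.≟ f)

get : List ℕ → ℕ → ℕ
get []       i       = 0
get (x ∷ xs) zero    = x
get (x ∷ xs) (suc i) = get xs i

infix 4 _~_ _≃_
_~_ : List ℕ → List ℕ → Set
xs ~ ys = ∀ i → get xs i ≡ get ys i

~-sym : ∀ {xs ys} → xs ~ ys → ys ~ xs
~-sym p i = sym (p i)

~-trans : ∀ {xs ys zs} → xs ~ ys → ys ~ zs → xs ~ zs
~-trans p q i = trans (p i) (q i)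

~-eq : ∀ xs ys → xs ~ ys → length xs ≡ length ys → xs ≡ ys
~-eq []       []       h e = refl
~-eq (x ∷ xs) (y ∷ ys) h e = cong₂ _∷_ (h 0) (~-eq xs ys (λ i → h (suc i)) (ℕₚ.suc-injective e))

get-beyond : ∀ t j → length t ≤ j → get t j ≡ 0
get-beyond []      j       h       = refl
get-beyond (x ∷ t) (suc j) (s≤s h) = get-beyond t j h

eqExp-sound : ∀ xs ys → eqExp xs ys ≡ true → xs ~ ys
eqExp-sound []       []       e i       = refl
eqExp-sound []       (y ∷ ys) e zero    = sym (ᵇ⇒ y 0 (∧-true₁ e))
eqExp-sound []       (y ∷ ys) e (suc i) = eqExp-sound [] ys (∧-true₂ {y ≡ᵇ 0} e) i
eqExp-sound (x ∷ xs) []       e zero    = ᵇ⇒ x 0 (∧-true₁ e)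
eqExp-sound (x ∷ xs) []       e (suc i) = eqExp-sound xs [] (∧-true₂ {x ≡ᵇ 0} e) i
eqExp-sound (x ∷ xs) (y ∷ ys) e zero    = ᵇ⇒ x y (∧-true₁ e)
eqExp-sound (x ∷ xs) (y ∷ ys) e (suc i) = eqExp-sound xs ys (∧-true₂ {x ≡ᵇ y} e) i

eqExp-complete : ∀ xs ys → xs ~ ys → eqExp xs ys ≡ true
eqExp-complete []       []       h = refl
eqExp-complete []       (y ∷ ys) h = ∧-intro (⇒ᵇ y 0 (sym (h 0))) (eqExp-complete [] ys (λ i → h (suc i)))
eqExp-complete (x ∷ xs) []       h = ∧-intro (⇒ᵇ x 0 (h 0)) (eqExp-complete xs [] (λ i → h (suc i)))
eqExp-complete (x ∷ xs) (y ∷ ys) h = ∧-intro (⇒ᵇ x y (h 0)) (eqExp-complete xs ys (λ i → h (suc i)))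

_≃_ : Mono → Mono → Set
(e , xs) ≃ (f , ys) = (e ≡ f) × (xs ~ ys)

eqMono-sound : ∀ m m′ → eqMono m m′ ≡ true → m ≃ m′
eqMono-sound (e , xs) (f , ys) h = ℤ≟-sound e f (∧-true₁ h) , eqExp-sound xs ys (∧-true₂ {does (e ℤ.≟ f)} h)

eqMono-complete : ∀ m m′ → m ≃ m′ → eqMono m m′ ≡ true
eqMono-complete (e , xs) (f , ys) (p , q) = ∧-intro (ℤ≟-complete e f p) (eqExp-complete xs ys q)

contrib : Mono → ℤ × Mono → ℤ
contrib m (c , m′) = if eqMono m′ m then c else + 0

contrib-* : ∀ l c m m′ → contrib m (l ℤ.* c , m′) ≡ l ℤ.* contrib m (c , m′)
contrib-* l c m m′ with eqMono m′ m
... | true  = refl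
... | false = sym (ℤₚ.*-zeroʳ l)

contrib-0 : ∀ m m′ → contrib m (+ 0 , m′) ≡ + 0
contrib-0 m m′ with eqMono m′ m
... | true  = refl
... | false = refl

contrib-absent : ∀ c m m′ → ¬ (m′ ≃ m) → contrib m (c , m′) ≡ + 0
contrib-absent c m m′ h with eqMono m′ m in q
... | true  = ⊥-elim (h (eqMono-sound m′ m q))
... | false = refl

contrib-transport : ∀ c c′ m₁ m₂ m₁′ m₂′ → (m₁ ≃ m₂ → m₁′ ≃ m₂′) → (m₁′ ≃ m₂′ → m₁ ≃ m₂) →
  (m₁ ≃ m₂ → c ≡ c′) → contrib m₂ (c , m₁) ≡ contrib m₂′ (c′ , m₁′)
contrib-transport c c′ m₁ m₂ m₁′ m₂′ f g h with eqMono m₁ m₂ in q | eqMono m₁′ m₂′ in q′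
... | true  | true  = h (eqMono-sound m₁ m₂ q)
... | false | false = refl
... | true  | false = ⊥-elim (false≢true (trans (sym q′) (eqMono-complete m₁′ m₂′ (f (eqMono-sound m₁ m₂ q)))))
... | false | true  = ⊥-elim (false≢true (trans (sym q) (eqMono-complete m₁ m₂ (g (eqMono-sound m₁′ m₂′ q′)))))

coeff-cons : ∀ t p m → coeff (t ∷ p) m ≡ contrib m t ℤ.+ coeff p m
coeff-cons (c , m′) p m with eqMono m′ m
... | true  = refl
... | false = sym (ℤₚ.+-identityˡ _)

coeff-as-sum : ∀ p m → coeff p m ≡ sumℤ (map (contrib m) p)
coeff-as-sum []      m = refl
coeff-as-sum (t ∷ p) m = trans (coeff-cons t p m) (cong (λ z → contrib m t ℤ.+ z) (coeff-as-sum p m))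

sumℤ-ext : ∀ {A : Set} (g h : A → ℤ) → (∀ t → g t ≡ h t) → ∀ l → sumℤ (map g l) ≡ sumℤ (map h l)
sumℤ-ext g h e []      = refl
sumℤ-ext g h e (t ∷ l) = cong₂ ℤ._+_ (e t) (sumℤ-ext g h e l)

sumℤ-zero : ∀ {A : Set} (g : A → ℤ) → (∀ t → g t ≡ + 0) → ∀ l → sumℤ (map g l) ≡ + 0
sumℤ-zero g e []      = refl
sumℤ-zero g e (t ∷ l) = cong₂ ℤ._+_ (e t) (sumℤ-zero g e l)

sumℤ-++ : ∀ a b → sumℤ (a ++ b) ≡ sumℤ a ℤ.+ sumℤ b
sumℤ-++ []      b = sym (ℤₚ.+-identityˡ _)
sumℤ-++ (x ∷ a) b = trans (cong (λ z → x ℤ.+ z) (sumℤ-++ a b)) (sym (ℤₚ.+-assoc x _ _))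

sumℤ-* : ∀ {A : Set} l (g : A → ℤ) xs → sumℤ (map (λ x → l ℤ.* g x) xs) ≡ l ℤ.* sumℤ (map g xs)
sumℤ-* l g []       = sym (ℤₚ.*-zeroʳ l)
sumℤ-* l g (x ∷ xs) = trans (cong (λ z → l ℤ.* g x ℤ.+ z) (sumℤ-* l g xs)) (sym (ℤₚ.*-distribˡ-+ l _ _))

sumℤ-∘ : ∀ {A B : Set} (g : B → ℤ) (f : A → B) l → sumℤ (map g (map f l)) ≡ sumℤ (map (g ∘ f) l)
sumℤ-∘ g f l = cong sumℤ (sym (Listₚ.map-∘ l))

coeff-++ : ∀ p q m → coeff (p ++ q) m ≡ coeff p m ℤ.+ coeff q m
coeff-++ p q m = begin
  coeff (p ++ q) m                                        ≡⟨ coeff-as-sum (p ++ q) m ⟩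
  sumℤ (map (contrib m) (p ++ q))                         ≡⟨ cong sumℤ (Listₚ.map-++ (contrib m) p q) ⟩
  sumℤ (map (contrib m) p ++ map (contrib m) q)           ≡⟨ sumℤ-++ (map (contrib m) p) _ ⟩
  sumℤ (map (contrib m) p) ℤ.+ sumℤ (map (contrib m) q)   ≡⟨ sym (cong₂ ℤ._+_ (coeff-as-sum p m) (coeff-as-sum q m)) ⟩
  coeff p m ℤ.+ coeff q m                                 ∎
  where open ≡-Reasoning

coeff-map : ∀ (φ : ℤ × Mono → ℤ × Mono) (l : ℤ) m m′ →
  (∀ t → contrib m (φ t) ≡ l ℤ.* contrib m′ t) → ∀ p → coeff (map φ p) m ≡ l ℤ.* coeff p m′
coeff-map φ l m m′ h p = begin
  coeff (map φ p) m                    ≡⟨ coeff-as-sum (map φ p) m ⟩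
  sumℤ (map (contrib m) (map φ p))     ≡⟨ sumℤ-∘ (contrib m) φ p ⟩
  sumℤ (map (contrib m ∘ φ) p)         ≡⟨ sumℤ-ext _ _ h p ⟩
  sumℤ (map (λ t → l ℤ.* contrib m′ t) p) ≡⟨ sumℤ-* l (contrib m′) p ⟩
  l ℤ.* sumℤ (map (contrib m′) p)      ≡⟨ cong (l ℤ.*_) (sym (coeff-as-sum p m′)) ⟩
  l ℤ.* coeff p m′                     ∎
  where open ≡-Reasoning

coeff-scale : ∀ c p m → coeff (scale c p) m ≡ c ℤ.* coeff p m
coeff-scale c p m = coeff-map _ c m m (λ { (d , m′) → contrib-* c d m m′ }) p

coeff-sumP : ∀ ps m → coeff (sumP ps) m ≡ sumℤ (map (λ p → coeff p m) ps)
coeff-sumP []       m = refl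
coeff-sumP (p ∷ ps) m = trans (coeff-++ p (sumP ps) m) (cong (λ z → coeff p m ℤ.+ z) (coeff-sumP ps m))

coeff-filter : ∀ (P : ℤ × Mono → Bool) p m →
  coeff (filterᵇ P p) m ≡ sumℤ (map (λ t → if P t then contrib m t else + 0) p)
coeff-filter P []      m = refl
coeff-filter P (t ∷ p) m with P t
... | true  = trans (coeff-cons t (filterᵇ P p) m) (cong (λ z → contrib m t ℤ.+ z) (coeff-filter P p m))
... | false = trans (coeff-filter P p m) (sym (ℤₚ.+-identityˡ _))

coeff-term-* : ∀ c n p m → coeff (((c , n) ∷ []) *P p) m ≡ coeff (map (λ { (d , n′) → (c ℤ.* d , mulMono n n′) }) p) m
coeff-term-* c n p m = trans (coeff-++ (map _ p) [] m) (ℤₚ.+-identityʳ _)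

-- Exponent-list arithmetic: ind i j is the Kronecker delta, δ i the exponent list
-- of X_{i+2}; inc i and dec i raise and lower the i-th exponent by one.

ind : ℕ → ℕ → ℕ
ind zero    zero    = 1
ind zero    (suc j) = 0
ind (suc i) zero    = 0
ind (suc i) (suc j) = ind i j

ind-refl : ∀ i → ind i i ≡ 1
ind-refl zero    = refl
ind-refl (suc i) = ind-refl i

ind-neq : ∀ i j → i ≢ j → ind i j ≡ 0
ind-neq zero    zero    h = ⊥-elim (h refl)
ind-neq zero    (suc j) h = refl
ind-neq (suc i) zero    h = refl
ind-neq (suc i) (suc j) h = ind-neq i j (λ e → h (cong suc e))

ind-le : ∀ i j ys → 1 ≤ get ys i → ind i j ≤ get ys j
ind-le i j ys h with i ℕₚ.≟ j
... | yes refl rewrite ind-refl i = h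
... | no q     rewrite ind-neq i j q = z≤n

δ : ℕ → List ℕ
δ i = replicate i 0 ++ (1 ∷ [])

get-δ : ∀ i j → get (δ i) j ≡ ind i j
get-δ zero    zero    = refl
get-δ zero    (suc j) = refl
get-δ (suc i) zero    = refl
get-δ (suc i) (suc j) = get-δ i j

get-addExp : ∀ a b j → get (addExp a b) j ≡ get a j + get b j
get-addExp []      b       j       = refl
get-addExp (x ∷ a) []      zero    = sym (ℕₚ.+-identityʳ x)
get-addExp (x ∷ a) []      (suc j) = sym (ℕₚ.+-identityʳ _)
get-addExp (x ∷ a) (y ∷ b) zero    = refl
get-addExp (x ∷ a) (y ∷ b) (suc j) = get-addExp a b j

get-addδ : ∀ i xs j → get (addExp (δ i) xs) j ≡ ind i j + get xs j
get-addδ i xs j rewrite get-addExp (δ i) xs j | get-δ i j = refl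

inc : ℕ → List ℕ → List ℕ
inc i       []       = δ i
inc zero    (y ∷ ys) = suc y ∷ ys
inc (suc i) (y ∷ ys) = y ∷ inc i ys

dec : ℕ → List ℕ → List ℕ
dec i       []       = []
dec zero    (y ∷ ys) = (y ∸ 1) ∷ ys
dec (suc i) (y ∷ ys) = y ∷ dec i ys

get-inc : ∀ i ys j → get (inc i ys) j ≡ get ys j + ind i j
get-inc i       []       j       = get-δ i j
get-inc zero    (y ∷ ys) zero    = ℕₚ.+-comm 1 y
get-inc zero    (y ∷ ys) (suc j) = sym (ℕₚ.+-identityʳ _)
get-inc (suc i) (y ∷ ys) zero    = sym (ℕₚ.+-identityʳ _)
get-inc (suc i) (y ∷ ys) (suc j) = get-inc i ys j

get-dec : ∀ i ys j → get (dec i ys) j ≡ get ys j ∸ ind i j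
get-dec i       []       j       = sym (ℕₚ.0∸n≡0 (ind i j))
get-dec zero    (y ∷ ys) zero    = refl
get-dec zero    (y ∷ ys) (suc j) = refl
get-dec (suc i) (y ∷ ys) zero    = refl
get-dec (suc i) (y ∷ ys) (suc j) = get-dec i ys j

inc-dec : ∀ i xs ys → 1 ≤ get xs i → dec i xs ~ ys → xs ~ inc i ys
inc-dec i xs ys h v j = begin
  get xs j                      ≡⟨ sym (ℕₚ.m∸n+n≡m (ind-le i j xs h)) ⟩
  get xs j ∸ ind i j + ind i j  ≡⟨ cong (_+ ind i j) (trans (sym (get-dec i xs j)) (v j)) ⟩
  get ys j + ind i j            ≡⟨ sym (get-inc i ys j) ⟩
  get (inc i ys) j              ∎
  where open ≡-Reasoning

dec-inc : ∀ i xs ys → xs ~ inc i ys → dec i xs ~ ys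
dec-inc i xs ys v j = begin
  get (dec i xs) j              ≡⟨ get-dec i xs j ⟩
  get xs j ∸ ind i j            ≡⟨ cong (_∸ ind i j) (trans (v j) (get-inc i ys j)) ⟩
  get ys j + ind i j ∸ ind i j  ≡⟨ ℕₚ.m+n∸n≡m (get ys j) (ind i j) ⟩
  get ys j                      ∎
  where open ≡-Reasoning

addδ~inc : ∀ i xs → addExp (δ i) xs ~ inc i xs
addδ~inc i xs j = trans (get-addδ i xs j) (trans (ℕₚ.+-comm (ind i j) _) (sym (get-inc i xs j)))

dExp-eq : ∀ i xs → dExp i xs ≡ (get xs i , dec i xs)
dExp-eq i       []       = refl
dExp-eq zero    (x ∷ xs) = refl
dExp-eq (suc i) (x ∷ xs) rewrite dExp-eq i xs = refl

-- whenPos y x is x if y > 0 and 0 otherwise: the effect of dividing by X_{i+2}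
whenPos : ℕ → ℤ → ℤ
whenPos zero    x = + 0
whenPos (suc _) x = x

whenPos-0 : ∀ y → whenPos y (+ 0) ≡ + 0
whenPos-0 zero    = refl
whenPos-0 (suc y) = refl

shift-cancelˡ : ∀ a b → (a ℤ.+ b) ℤ.- a ≡ b
shift-cancelˡ = ℤ-solve

shift-cancelʳ : ∀ a b → a ℤ.+ (b ℤ.- a) ≡ b
shift-cancelʳ = ℤ-solve

pred-suc : ∀ a → (a ℤ.+ + 1) ℤ.- + 1 ≡ a
pred-suc = ℤ-solve

suc-pred : ∀ a → a ≡ (a ℤ.- + 1) ℤ.+ + 1
suc-pred = ℤ-solve

coeff-X₁^ : ∀ r p f ys → coeff (X₁^ r *P p) (f , ys) ≡ coeff p (f ℤ.- + r , ys)
coeff-X₁^ r p f ys = trans (coeff-term-* (+ 1) (+ r , []) p (f , ys))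
  (trans (coeff-map _ (+ 1) (f , ys) (f ℤ.- + r , ys) (λ { (d , (e , xs)) → shift d e xs }) p) (ℤₚ.*-identityˡ _))
  where
  shift : ∀ d e xs → contrib (f , ys) (+ 1 ℤ.* d , (+ r ℤ.+ e , xs)) ≡ + 1 ℤ.* contrib (f ℤ.- + r , ys) (d , (e , xs))
  shift d e xs = trans (contrib-* (+ 1) d (f , ys) (+ r ℤ.+ e , xs)) (cong (+ 1 ℤ.*_)
    (contrib-transport d d (+ r ℤ.+ e , xs) (f , ys) (e , xs) (f ℤ.- + r , ys)
      (λ { (u , v) → trans (sym (shift-cancelˡ (+ r) e)) (cong (ℤ._- + r) u) , v })
      (λ { (u , v) → trans (cong (λ z → + r ℤ.+ z) u) (shift-cancelʳ (+ r) f) , v })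
      (λ _ → refl)))

coeff-X₁ : ∀ p f ys → coeff (X 1 *P p) (f , ys) ≡ coeff p (f ℤ.- + 1 , ys)
coeff-X₁ = coeff-X₁^ 1

coeff-Xj : ∀ i p f ys → coeff (X (suc (suc i)) *P p) (f , ys) ≡ whenPos (get ys i) (coeff p (f , dec i ys))
coeff-Xj i p f ys = trans (coeff-term-* (+ 1) (+ 0 , δ i) p (f , ys)) (go (get ys i) refl)
  where
  φ : ℤ × Mono → ℤ × Mono
  φ = λ { (d , n′) → (+ 1 ℤ.* d , mulMono (+ 0 , δ i) n′) }
  go : ∀ y → get ys i ≡ y → coeff (map φ p) (f , ys) ≡ whenPos y (coeff p (f , dec i ys))
  go zero gy = coeff-map φ (+ 0) (f , ys) (f , ys) (λ { (d , (e , xs)) → absent d e xs }) p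
    where
    absent : ∀ d e xs → contrib (f , ys) (φ (d , (e , xs))) ≡ + 0 ℤ.* contrib (f , ys) (d , (e , xs))
    absent d e xs = trans (contrib-absent (+ 1 ℤ.* d) (f , ys) (+ 0 ℤ.+ e , addExp (δ i) xs) λ { (_ , v) →
      ℕₚ.1+n≢0 (trans (sym (trans (get-addδ i xs i) (cong (_+ get xs i) (ind-refl i)))) (trans (v i) gy)) })
      (sym (ℤₚ.*-zeroˡ (contrib (f , ys) (d , (e , xs)))))
  go (suc a) gy = trans (coeff-map φ (+ 1) (f , ys) (f , dec i ys) (λ { (d , (e , xs)) → present d e xs }) p)
    (ℤₚ.*-identityˡ _)
    where
    pos : 1 ≤ get ys i
    pos = subst (1 ≤_) (sym gy) (s≤s z≤n)
    divide : ∀ xs → addExp (δ i) xs ~ ys → xs ~ dec i ys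
    divide xs v = ~-sym {dec i ys} {xs} (dec-inc i ys xs (~-trans {ys} {addExp (δ i) xs} {inc i xs} (~-sym {addExp (δ i) xs} {ys} v) (addδ~inc i xs)))
    multiply : ∀ xs → xs ~ dec i ys → addExp (δ i) xs ~ ys
    multiply xs v = ~-trans {addExp (δ i) xs} {inc i xs} {ys} (addδ~inc i xs) (~-sym {ys} {inc i xs} (inc-dec i ys xs pos (~-sym {xs} {dec i ys} v)))
    present : ∀ d e xs → contrib (f , ys) (φ (d , (e , xs))) ≡ + 1 ℤ.* contrib (f , dec i ys) (d , (e , xs))
    present d e xs = trans (contrib-* (+ 1) d (f , ys) (+ 0 ℤ.+ e , addExp (δ i) xs))
      (cong (+ 1 ℤ.*_) (contrib-transport d d (+ 0 ℤ.+ e , addExp (δ i) xs) (f , ys) (e , xs) (f , dec i ys)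
        (λ { (u , v) → trans (sym (ℤₚ.+-identityˡ e)) u , divide xs v })
        (λ { (u , v) → trans (ℤₚ.+-identityˡ e) u , multiply xs v })
        (λ _ → refl)))

coeff-∂₁ : ∀ p f ys → coeff (∂ 1 p) (f , ys) ≡ (f ℤ.+ + 1) ℤ.* coeff p (f ℤ.+ + 1 , ys)
coeff-∂₁ p f ys = coeff-map _ (f ℤ.+ + 1) (f , ys) (f ℤ.+ + 1 , ys) (λ { (c , (e , xs)) → lower c e xs }) p
  where
  lower : ∀ c e xs → contrib (f , ys) (c ℤ.* e , (e ℤ.- + 1 , xs)) ≡ (f ℤ.+ + 1) ℤ.* contrib (f ℤ.+ + 1 , ys) (c , (e , xs))
  lower c e xs = trans
    (contrib-transport (c ℤ.* e) ((f ℤ.+ + 1) ℤ.* c) (e ℤ.- + 1 , xs) (f , ys) (e , xs) (f ℤ.+ + 1 , ys)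
      (λ { (u , v) → up u , v }) (λ { (u , v) → down u , v })
      (λ { (u , v) → trans (ℤₚ.*-comm c e) (cong (ℤ._* c) (up u)) }))
    (contrib-* (f ℤ.+ + 1) c (f ℤ.+ + 1 , ys) (e , xs))
    where
    up : e ℤ.- + 1 ≡ f → e ≡ f ℤ.+ + 1
    up a = trans (suc-pred e) (cong (ℤ._+ + 1) a)
    down : e ≡ f ℤ.+ + 1 → e ℤ.- + 1 ≡ f
    down a = trans (cong (ℤ._- + 1) a) (pred-suc f)

coeff-∂j : ∀ i p f ys → coeff (∂ (suc (suc i)) p) (f , ys) ≡ + suc (get ys i) ℤ.* coeff p (f , inc i ys)
coeff-∂j i p f ys = coeff-map _ (+ suc (get ys i)) (f , ys) (f , inc i ys) (λ { (c , (e , xs)) → lower c e xs }) p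
  where
  lower : ∀ c e xs → contrib (f , ys) (c ℤ.* + proj₁ (dExp i xs) , (e , proj₂ (dExp i xs)))
                     ≡ + suc (get ys i) ℤ.* contrib (f , inc i ys) (c , (e , xs))
  lower c e xs rewrite dExp-eq i xs with get xs i in gx
  ... | zero = trans (cong (λ z → contrib (f , ys) (z , (e , dec i xs))) (ℤₚ.*-zeroʳ c))
    (trans (contrib-0 (f , ys) (e , dec i xs))
           (sym (trans (cong (+ suc (get ys i) ℤ.*_) (contrib-absent c (f , inc i ys) (e , xs) noMatch)) (ℤₚ.*-zeroʳ (+ suc (get ys i))))))
    where
    noMatch : ¬ ((e , xs) ≃ (f , inc i ys))
    noMatch (_ , v) = ℕₚ.1+n≢0 (trans (sym (trans (get-inc i ys i)
      (trans (cong (get ys i ℕ.+_) (ind-refl i)) (ℕₚ.+-comm (get ys i) 1)))) (trans (sym (v i)) gx))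
  ... | suc a = trans
    (contrib-transport (c ℤ.* + suc a) (+ suc (get ys i) ℤ.* c) (e , dec i xs) (f , ys) (e , xs) (f , inc i ys)
      (λ { (u , v) → u , inc-dec i xs ys pos v }) (λ { (u , v) → u , dec-inc i xs ys v })
      (λ { (u , v) → trans (ℤₚ.*-comm c (+ suc a)) (cong (λ z → + suc z ℤ.* c) (lowered v)) }))
    (contrib-* (+ suc (get ys i)) c (f , inc i ys) (e , xs))
    where
    pos : 1 ≤ get xs i
    pos = subst (1 ≤_) (sym gx) (s≤s z≤n)
    lowered : dec i xs ~ ys → a ≡ get ys i
    lowered v = trans (cong (_∸ 1) (sym gx)) (trans (cong (get xs i ∸_) (sym (ind-refl i))) (trans (sym (get-dec i xs i)) (v i)))

coeff-killX₁-0 : ∀ p ys → coeff (killX₁ p) (+ 0 , ys) ≡ coeff p (+ 0 , ys)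
coeff-killX₁-0 p ys = trans (coeff-filter _ p (+ 0 , ys))
  (trans (sumℤ-ext _ (contrib (+ 0 , ys)) (λ { (c , (e , xs)) → collapse (does (e ℤ.≟ + 0)) c (eqExp xs ys) }) p)
         (sym (coeff-as-sum p _)))
  where
  collapse : ∀ (b : Bool) (c : ℤ) (b′ : Bool) → (if b then (if b ∧ b′ then c else + 0) else + 0) ≡ (if b ∧ b′ then c else + 0)
  collapse true  c b′ = refl
  collapse false c b′ = refl

coeff-killX₁-≠ : ∀ p f ys → f ≢ + 0 → coeff (killX₁ p) (f , ys) ≡ + 0
coeff-killX₁-≠ p f ys h = trans (coeff-filter _ p (f , ys)) (sumℤ-zero _ (λ { (c , (e , xs)) → vanish c e xs }) p)
  where
  vanish : ∀ c e xs → (if does (e ℤ.≟ + 0) then contrib (f , ys) (c , (e , xs)) else + 0) ≡ + 0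
  vanish c e xs with does (e ℤ.≟ + 0) in q
  ... | false = refl
  ... | true  = contrib-absent c (f , ys) (e , xs) (λ { (u , _) → h (trans (sym u) (ℤ≟-sound e (+ 0) q)) })

coeffS : ℕ → ℕ → Mono → ℤ
coeffS n k = coeff (S n k)

κ : ℕ → ℤ
κ n = ℤ.- (+ (2 * n) ℤ.- + 1)

derivTerm : (Mono → ℤ) → ℤ → List ℕ → ℕ → ℤ
derivTerm c f ys zero    = whenPos (get ys 0) ((f ℤ.+ + 1) ℤ.* c (f ℤ.+ + 1 , dec 0 ys))
derivTerm c f ys (suc i) = whenPos (get ys (suc i)) (+ suc (get (dec (suc i) ys) i) ℤ.* c (f , inc i (dec (suc i) ys)))

coeff-derivTerm : ∀ p f ys i → coeff (X (suc (suc i)) *P ∂ (suc i) p) (f , ys) ≡ derivTerm (coeff p) f ys i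
coeff-derivTerm p f ys zero    = trans (coeff-Xj 0 (∂ 1 p) f ys) (cong (whenPos (get ys 0)) (coeff-∂₁ p f (dec 0 ys)))
coeff-derivTerm p f ys (suc i) =
  trans (coeff-Xj (suc i) (∂ (suc (suc i)) p) f ys) (cong (whenPos (get ys (suc i))) (coeff-∂j i p f (dec (suc i) ys)))

recurrence : ℕ → ℕ → (Mono → ℤ) → (Mono → ℤ) → ℤ → List ℕ → ℤ
recurrence n k c d e ys = κ n ℤ.* whenPos (get ys 0) (c (e , dec 0 ys))
  ℤ.+ (d (e ℤ.- + 1 , ys) ℤ.+ sumℤ (map (derivTerm c (e ℤ.- + 1) ys) (upTo (n ∸ k))))

S-step : ∀ n k e ys → k ≤ n → coeffS (suc n) (suc k) (e , ys) ≡ recurrence n k (coeffS n (suc k)) (coeffS n k) e ys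
S-step n k e ys h rewrite ≤⇒<ᵇ-false {n} {k} h =
  trans (coeff-++ (scale (κ n) (X 2 *P S n (suc k))) (X 1 *P (S n k +P sumP derivs)) (e , ys))
        (cong₂ ℤ._+_ x₂-part x₁-part)
  where
  e′ = e ℤ.- + 1
  derivs : List Poly
  derivs = map (λ i → X (suc (suc i)) *P ∂ (suc i) (S n (suc k))) (upTo (n ∸ k))
  x₂-part : coeff (scale (κ n) (X 2 *P S n (suc k))) (e , ys) ≡ κ n ℤ.* whenPos (get ys 0) (coeffS n (suc k) (e , dec 0 ys))
  x₂-part = trans (coeff-scale (κ n) (X 2 *P S n (suc k)) (e , ys)) (cong (κ n ℤ.*_) (coeff-Xj 0 (S n (suc k)) e ys))
  derivs-part : coeff (sumP derivs) (e′ , ys) ≡ sumℤ (map (derivTerm (coeffS n (suc k)) e′ ys) (upTo (n ∸ k)))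
  derivs-part = trans (coeff-sumP derivs (e′ , ys)) (trans (sumℤ-∘ (λ p → coeff p (e′ , ys)) _ (upTo (n ∸ k)))
    (sumℤ-ext _ _ (coeff-derivTerm (S n (suc k)) e′ ys) (upTo (n ∸ k))))
  x₁-part : coeff (X 1 *P (S n k +P sumP derivs)) (e , ys) ≡ coeffS n k (e′ , ys) ℤ.+ sumℤ (map (derivTerm (coeffS n (suc k)) e′ ys) (upTo (n ∸ k)))
  x₁-part = trans (coeff-X₁ (S n k +P sumP derivs) e ys)
    (trans (coeff-++ (S n k) (sumP derivs) (e′ , ys)) (cong (λ z → coeffS n k (e′ , ys) ℤ.+ z) derivs-part))

recurrence-ext : ∀ n k {c c′ d d′} → (∀ m → c m ≡ c′ m) → (∀ m → d m ≡ d′ m) → ∀ e ys →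
  recurrence n k c d e ys ≡ recurrence n k c′ d′ e ys
recurrence-ext n k {c} {c′} hc hd e ys =
  cong₂ ℤ._+_ (cong (λ z → κ n ℤ.* whenPos (get ys 0) z) (hc _))
    (cong₂ ℤ._+_ (hd _) (sumℤ-ext _ _ (derivTerm-ext (e ℤ.- + 1)) (upTo (n ∸ k))))
  where
  derivTerm-ext : ∀ f i → derivTerm c f ys i ≡ derivTerm c′ f ys i
  derivTerm-ext f zero    = cong (λ z → whenPos (get ys 0) ((f ℤ.+ + 1) ℤ.* z)) (hc _)
  derivTerm-ext f (suc i) = cong (λ z → whenPos (get ys (suc i)) (+ suc (get (dec (suc i) ys) i) ℤ.* z)) (hc _)

-- For an exponent list ys (of X₂, X₃, …) let size ys = Σ yⱼ,
-- weight ys = Σ (j+2) yⱼ and denom₂ ys = ∏ yⱼ! ((j+2)!)^{yⱼ}; then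
-- β ys = weight! / denom₂ is the coefficient of X^ys in the Bell polynomial.

size : List ℕ → ℕ
size = sumℕ

weight : List ℕ → ℕ
weight = weighted 2

denom₂ : List ℕ → ℕ
denom₂ = denom 2

β : List ℕ → ℕ
β ys = (weight ys !) div (denom₂ ys)

sumℕ-resp : ∀ xs ys → xs ~ ys → sumℕ xs ≡ sumℕ ys
sumℕ-resp []       []       h = refl
sumℕ-resp []       (y ∷ ys) h rewrite sym (h 0) = sumℕ-resp [] ys (λ i → h (suc i))
sumℕ-resp (x ∷ xs) []       h rewrite h 0 = sumℕ-resp xs [] (λ i → h (suc i))
sumℕ-resp (x ∷ xs) (y ∷ ys) h = cong₂ _+_ (h 0) (sumℕ-resp xs ys (λ i → h (suc i)))

weighted-resp : ∀ w xs ys → xs ~ ys → weighted w xs ≡ weighted w ys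
weighted-resp w []       []       h = refl
weighted-resp w []       (y ∷ ys) h rewrite sym (h 0) | ℕₚ.*-zeroʳ w = weighted-resp (suc w) [] ys (λ i → h (suc i))
weighted-resp w (x ∷ xs) []       h rewrite h 0 | ℕₚ.*-zeroʳ w = weighted-resp (suc w) xs [] (λ i → h (suc i))
weighted-resp w (x ∷ xs) (y ∷ ys) h = cong₂ _+_ (cong (w *_) (h 0)) (weighted-resp (suc w) xs ys (λ i → h (suc i)))

denom-resp : ∀ w xs ys → xs ~ ys → denom w xs ≡ denom w ys
denom-resp w []       []       h = refl
denom-resp w []       (y ∷ ys) h rewrite sym (h 0) =
  trans (denom-resp (suc w) [] ys (λ i → h (suc i))) (sym (ℕₚ.+-identityʳ _))
denom-resp w (x ∷ xs) []       h rewrite h 0 =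
  trans (ℕₚ.+-identityʳ _) (denom-resp (suc w) xs [] (λ i → h (suc i)))
denom-resp w (x ∷ xs) (y ∷ ys) h =
  cong₂ _*_ (cong₂ _*_ (cong _! (h 0)) (cong ((w !) ^_) (h 0))) (denom-resp (suc w) xs ys (λ i → h (suc i)))

β-resp : ∀ xs ys → xs ~ ys → β xs ≡ β ys
β-resp xs ys h rewrite weighted-resp 2 xs ys h | denom-resp 2 xs ys h = refl

weighted-split : ∀ a b ys → weighted (a + b) ys ≡ a * sumℕ ys + weighted b ys
weighted-split a b []       = sym (trans (ℕₚ.+-identityʳ (a * 0)) (ℕₚ.*-zeroʳ a))
weighted-split a b (y ∷ ys) rewrite sym (ℕₚ.+-suc a b) | weighted-split a (suc b) ys =
  regroup a b y (sumℕ ys) (weighted (suc b) ys)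
  where
  regroup : ∀ a b y s w → (a + b) * y + (a * s + w) ≡ a * (y + s) + (b * y + w)
  regroup = ℕ-solve

get≤sumℕ : ∀ ys j → get ys j ≤ sumℕ ys
get≤sumℕ []       j       = z≤n
get≤sumℕ (y ∷ ys) zero    = ℕₚ.m≤m+n y _
get≤sumℕ (y ∷ ys) (suc j) = ℕₚ.≤-trans (get≤sumℕ ys j) (ℕₚ.m≤n+m _ y)

weighted0≥ : ∀ ys j → 1 ≤ get ys j → j ≤ weighted 0 ys
weighted0≥ (y ∷ ys) zero    h = z≤n
weighted0≥ (y ∷ ys) (suc j) h rewrite weighted-split 1 0 ys | ℕₚ.*-identityˡ (sumℕ ys) =
  ℕₚ.+-mono-≤ (ℕₚ.≤-trans h (get≤sumℕ ys j)) (weighted0≥ ys j h)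

2size≤weight : ∀ ys → 2 * size ys ≤ weight ys
2size≤weight ys rewrite weighted-split 2 0 ys = ℕₚ.m≤m+n _ _

2size+j≤weight : ∀ ys j → 1 ≤ get ys j → 2 * size ys + j ≤ weight ys
2size+j≤weight ys j h rewrite weighted-split 2 0 ys = ℕₚ.+-monoʳ-≤ (2 * size ys) (weighted0≥ ys j h)

size≤weight : ∀ ys → size ys ≤ weight ys
size≤weight ys = ℕₚ.≤-trans (ℕₚ.m≤m+n (size ys) (size ys + 0)) (2size≤weight ys)

size0⇒~[] : ∀ ys → size ys ≡ 0 → ys ~ []
size0⇒~[] ys h j = ℕₚ.n≤0⇒n≡0 (subst (get ys j ≤_) h (get≤sumℕ ys j))

weight0⇒~[] : ∀ ys → weight ys ≡ 0 → ys ~ []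
weight0⇒~[] ys h = size0⇒~[] ys (ℕₚ.n≤0⇒n≡0 (ℕₚ.≤-trans (size≤weight ys) (ℕₚ.≤-reflexive h)))

β[] : ∀ ys → ys ~ [] → β ys ≡ 1
β[] ys h = β-resp ys [] h

denom-nz : ∀ w ys → ℕ.NonZero (denom w ys)
denom-nz w []       = _
denom-nz w (y ∷ ys) = ℕₚ.m*n≢0 (y ! * ((w !) ^ y)) (denom (suc w) ys)
  {{ℕₚ.m*n≢0 (y !) ((w !) ^ y) {{y ℕₚ.!≢0}} {{ℕₚ.m^n≢0 (w !) y {{w ℕₚ.!≢0}}}}}} {{denom-nz (suc w) ys}}

div-exact : ∀ m d q → ℕ.NonZero d → d * q ≡ m → m div d ≡ q
div-exact m (suc d) q _ e rewrite sym e | ℕₚ.*-comm (suc d) q = m*n/n≡m q (suc d)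

Exact : (List ℕ → ℕ) → List ℕ → Set
Exact Q ys = denom₂ ys * Q ys ≡ weight ys !

β-unique : ∀ ys q → denom₂ ys * q ≡ weight ys ! → β ys ≡ q
β-unique ys q e = div-exact (weight ys !) (denom₂ ys) q (denom-nz 2 ys) e

-- Lowering exponents.  dec 0 removes a factor X₂; lowerAt j replaces a factor
-- X_{j+3} by X_{j+2}.  These are the monomials that the derivation
-- X₂ ∂₁ + X₃ ∂₂ + ⋯ maps onto X^ys (up to the factor X₁).

lowerAt : ℕ → List ℕ → List ℕ
lowerAt j ys = inc j (dec (suc j) ys)

weight-dec₀ : ∀ a t → weight (suc a ∷ t) ≡ 2 + weight (a ∷ t)
weight-dec₀ a t = regroup a (weighted 3 t)
  where
  regroup : ∀ a w → 2 * suc a + w ≡ 2 + (2 * a + w)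
  regroup = ℕ-solve

denom₂-dec₀ : ∀ a t → denom₂ (suc a ∷ t) ≡ 2 * suc a * denom₂ (a ∷ t)
denom₂-dec₀ a t = regroup a (a !) (2 ^ a) (denom 3 t)
  where
  regroup : ∀ a f p d → (f + a * f) * (2 * p) * d ≡ 2 * suc a * (f * p * d)
  regroup = ℕ-solve

size-lowerAt : ∀ j ys a → get ys (suc j) ≡ suc a → size (lowerAt j ys) ≡ size ys
size-lowerAt zero    (y0 ∷ y1 ∷ t) a refl = regroup y0 a (sumℕ t)
  where
  regroup : ∀ y a s → suc y + (a + s) ≡ y + (suc a + s)
  regroup = ℕ-solve
size-lowerAt (suc j) (y ∷ t)       a h    = cong (y ℕ.+_) (size-lowerAt j t a h)

weighted-lowerAt : ∀ w j ys a → get ys (suc j) ≡ suc a → suc (weighted w (lowerAt j ys)) ≡ weighted w ys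
weighted-lowerAt w zero    (y0 ∷ y1 ∷ t) a refl = regroup w y0 a (weighted (suc (suc w)) t)
  where
  regroup : ∀ w y a r → suc (w * suc y + (suc w * a + r)) ≡ w * y + (suc w * suc a + r)
  regroup = ℕ-solve
weighted-lowerAt w (suc j) (y ∷ t)       a h    =
  trans (sym (ℕₚ.+-suc (w * y) _)) (cong (w * y ℕ.+_) (weighted-lowerAt (suc w) j t a h))

denom-lowerAt : ∀ w j ys a → get ys (suc j) ≡ suc a →
  denom w ys * suc (get ys j) ≡ denom w (lowerAt j ys) * (suc a * (w + suc j))
denom-lowerAt w zero    (y0 ∷ y1 ∷ t) a refl =
  regroup w y0 a (y0 !) (a !) ((w !) ^ y0) ((suc w !) ^ a) (w !) (denom (suc (suc w)) t)
  where
  regroup : ∀ w y a fy fa p q fw d →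
    fy * p * ((fa + a * fa) * ((fw + w * fw) * q) * d) * suc y
    ≡ (fy + y * fy) * (fw * p) * (fa * q * d) * (suc a * (w + 1))
  regroup = ℕ-solve
denom-lowerAt w (suc j) (y ∷ t)       a h    = begin
  c * denom (suc w) t * suc (get t j)                    ≡⟨ ℕₚ.*-assoc c _ _ ⟩
  c * (denom (suc w) t * suc (get t j))                  ≡⟨ cong (c *_) (denom-lowerAt (suc w) j t a h) ⟩
  c * (denom (suc w) (lowerAt j t) * (suc a * (suc w + suc j))) ≡⟨ sym (ℕₚ.*-assoc c _ _) ⟩
  c * denom (suc w) (lowerAt j t) * (suc a * (suc w + suc j))   ≡⟨ cong (λ z → c * denom (suc w) (lowerAt j t) * (suc a * z)) (sym (ℕₚ.+-suc w (suc j))) ⟩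
  c * denom (suc w) (lowerAt j t) * (suc a * (w + suc (suc j))) ∎
  where
  open ≡-Reasoning
  c = y ! * ((w !) ^ y)

Σℕ : (ℕ → ℕ) → ℕ → ℕ
Σℕ f zero    = 0
Σℕ f (suc L) = f 0 + Σℕ (λ i → f (suc i)) L

Σℕ-ext : ∀ f g → (∀ i → f i ≡ g i) → ∀ L → Σℕ f L ≡ Σℕ g L
Σℕ-ext f g h zero    = refl
Σℕ-ext f g h (suc L) = cong₂ _+_ (h 0) (Σℕ-ext _ _ (λ i → h (suc i)) L)

Σℕ-* : ∀ c f L → c * Σℕ f L ≡ Σℕ (λ i → c * f i) L
Σℕ-* c f zero    = ℕₚ.*-zeroʳ c
Σℕ-* c f (suc L) = trans (ℕₚ.*-distribˡ-+ c (f 0) _) (cong (c * f 0 ℕ.+_) (Σℕ-* c _ L))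

Σℕ-extend : ∀ f L R → L ≤ R → (∀ i → L ≤ i → f i ≡ 0) → Σℕ f L ≡ Σℕ f R
Σℕ-extend f zero    zero    _       h = refl
Σℕ-extend f zero    (suc R) _       h =
  sym (trans (cong (_+ Σℕ (λ i → f (suc i)) R) (h 0 z≤n)) (sym (Σℕ-extend (λ i → f (suc i)) zero R z≤n (λ i _ → h (suc i) z≤n))))
Σℕ-extend f (suc L) (suc R) (s≤s le) h = cong (f 0 ℕ.+_) (Σℕ-extend _ L R le (λ i p → h (suc i) (s≤s p)))

weighted-Σℕ : ∀ w ys → weighted w ys ≡ Σℕ (λ j → (w + j) * get ys j) (length ys)
weighted-Σℕ w []       = refl
weighted-Σℕ w (y ∷ ys) = cong₂ _+_ (cong (_* y) (sym (ℕₚ.+-identityʳ w)))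
  (trans (weighted-Σℕ (suc w) ys) (Σℕ-ext _ _ (λ j → cong (_* get ys j) (sym (ℕₚ.+-suc w j))) (length ys)))

whenPosℕ : ℕ → ℕ → ℕ
whenPosℕ zero    x = 0
whenPosℕ (suc _) x = x

-- The recurrence for β.  bellStep Q ys collects the values of Q on the lowered
-- monomials with the multiplicities produced by the derivation; it sums to
-- weight! / denom₂ because Σ (j+2) yⱼ = weight.

bellStep : (List ℕ → ℕ) → List ℕ → ℕ
bellStep Q []       = 0
bellStep Q (y0 ∷ t) = (weight (y0 ∷ t) ∸ 1) * whenPosℕ y0 (Q (dec 0 (y0 ∷ t)))
  + Σℕ (λ j → whenPosℕ (get t j) (suc (get (y0 ∷ t) j) * Q (lowerAt j (y0 ∷ t)))) (length t)

-- the X₂-summand accounts for the share 2 y₀ of the weight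
denom-bellStep-X₂ : ∀ (Q : List ℕ → ℕ) y0 t M → weight (y0 ∷ t) ≡ suc M →
  (∀ a → y0 ≡ suc a → Exact Q (a ∷ t)) →
  denom₂ (y0 ∷ t) * ((weight (y0 ∷ t) ∸ 1) * whenPosℕ y0 (Q (dec 0 (y0 ∷ t)))) ≡ M ! * (2 * y0)
denom-bellStep-X₂ Q zero    t M hN H0 =
  trans (cong (denom₂ (0 ∷ t) *_) (ℕₚ.*-zeroʳ (weight (0 ∷ t) ∸ 1)))
        (trans (ℕₚ.*-zeroʳ (denom₂ (0 ∷ t))) (sym (ℕₚ.*-zeroʳ (M !))))
denom-bellStep-X₂ Q (suc a) t M hN H0 = begin
  denom₂ (suc a ∷ t) * (M′ * Q (a ∷ t))              ≡⟨ cong (_* (M′ * Q (a ∷ t))) (denom₂-dec₀ a t) ⟩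
  2 * suc a * denom₂ (a ∷ t) * (M′ * Q (a ∷ t))      ≡⟨ swap (2 * suc a) (denom₂ (a ∷ t)) M′ (Q (a ∷ t)) ⟩
  2 * suc a * M′ * (denom₂ (a ∷ t) * Q (a ∷ t))      ≡⟨ cong (2 * suc a * M′ *_) (H0 a refl) ⟩
  2 * suc a * M′ * N₀ !                              ≡⟨ cong (λ z → 2 * suc a * z * N₀ !) M′≡ ⟩
  2 * suc a * suc N₀ * N₀ !                          ≡⟨ swap′ (suc a) (suc N₀) (N₀ !) ⟩
  suc N₀ ! * (2 * suc a)                             ≡⟨ cong (λ z → z ! * (2 * suc a)) (sym M≡) ⟩
  M ! * (2 * suc a)                                  ∎
  where
  open ≡-Reasoning
  N₀ = weight (a ∷ t)
  M′ = weight (suc a ∷ t) ∸ 1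
  M≡ : M ≡ suc N₀
  M≡ = ℕₚ.suc-injective (trans (sym hN) (weight-dec₀ a t))
  M′≡ : M′ ≡ suc N₀
  M′≡ = trans (cong (_∸ 1) hN) M≡
  swap : ∀ c d m q → c * d * (m * q) ≡ c * m * (d * q)
  swap = ℕ-solve
  swap′ : ∀ b m f → 2 * b * m * f ≡ m * f * (2 * b)
  swap′ = ℕ-solve

-- the X_{j+3}-summand accounts for the share (j+3) t_j of the weight
denom-bellStep-Xj : ∀ (Q : List ℕ → ℕ) y0 t M → weight (y0 ∷ t) ≡ suc M → ∀ j →
  (∀ a → get t j ≡ suc a → Exact Q (lowerAt j (y0 ∷ t))) →
  denom₂ (y0 ∷ t) * whenPosℕ (get t j) (suc (get (y0 ∷ t) j) * Q (lowerAt j (y0 ∷ t))) ≡ M ! * ((3 + j) * get t j)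
denom-bellStep-Xj Q y0 t M hN j Hj with get t j in ej
... | zero  = trans (ℕₚ.*-zeroʳ (denom₂ ys)) (sym (trans (cong (M ! *_) (ℕₚ.*-zeroʳ (3 + j))) (ℕₚ.*-zeroʳ (M !))))
  where ys = y0 ∷ t
... | suc a = begin
  denom₂ ys * (suc (get ys j) * Q ys′)             ≡⟨ sym (ℕₚ.*-assoc (denom₂ ys) _ _) ⟩
  denom₂ ys * suc (get ys j) * Q ys′               ≡⟨ cong (_* Q ys′) (denom-lowerAt 2 j ys a ej) ⟩
  denom₂ ys′ * (suc a * (2 + suc j)) * Q ys′       ≡⟨ swap (denom₂ ys′) (suc a * (2 + suc j)) (Q ys′) ⟩
  denom₂ ys′ * Q ys′ * (suc a * (2 + suc j))       ≡⟨ cong (_* (suc a * (2 + suc j))) (Hj a refl) ⟩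
  weight ys′ ! * (suc a * (2 + suc j))             ≡⟨ cong (λ z → z ! * (suc a * (2 + suc j))) weight′ ⟩
  M ! * (suc a * (2 + suc j))                      ≡⟨ cong (M ! *_) (comm a j) ⟩
  M ! * ((3 + j) * suc a)                          ∎
  where
  open ≡-Reasoning
  ys = y0 ∷ t
  ys′ = lowerAt j ys
  weight′ : weight ys′ ≡ M
  weight′ = ℕₚ.suc-injective (trans (weighted-lowerAt 2 j ys a ej) hN)
  swap : ∀ d c q → d * c * q ≡ d * q * c
  swap = ℕ-solve
  comm : ∀ a j → suc a * (2 + suc j) ≡ (3 + j) * suc a
  comm = ℕ-solve

denom-bellStep : ∀ (Q : List ℕ → ℕ) y0 t M → weight (y0 ∷ t) ≡ suc M →
  (∀ a → y0 ≡ suc a → Exact Q (a ∷ t)) →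
  (∀ j a → get t j ≡ suc a → Exact Q (lowerAt j (y0 ∷ t))) →
  denom₂ (y0 ∷ t) * bellStep Q (y0 ∷ t) ≡ suc M !
denom-bellStep Q y0 t M hN H0 Hj = begin
  D * (X₂-part + Σℕ g (length t))                                   ≡⟨ ℕₚ.*-distribˡ-+ D _ _ ⟩
  D * X₂-part + D * Σℕ g (length t)                                 ≡⟨ cong₂ _+_ (denom-bellStep-X₂ Q y0 t M hN H0) Xj-parts ⟩
  M ! * (2 * y0) + M ! * Σℕ (λ j → (3 + j) * get t j) (length t)   ≡⟨ sym (ℕₚ.*-distribˡ-+ (M !) _ _) ⟩
  M ! * (2 * y0 + Σℕ (λ j → (3 + j) * get t j) (length t))         ≡⟨ cong (M ! *_) (trans (cong (2 * y0 ℕ.+_) (sym (weighted-Σℕ 3 t))) hN) ⟩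
  M ! * suc M                                                       ≡⟨ ℕₚ.*-comm (M !) (suc M) ⟩
  suc M !                                                           ∎
  where
  open ≡-Reasoning
  D = denom₂ (y0 ∷ t)
  X₂-part = (weight (y0 ∷ t) ∸ 1) * whenPosℕ y0 (Q (dec 0 (y0 ∷ t)))
  g = λ j → whenPosℕ (get t j) (suc (get (y0 ∷ t) j) * Q (lowerAt j (y0 ∷ t)))
  Xj-parts : D * Σℕ g (length t) ≡ M ! * Σℕ (λ j → (3 + j) * get t j) (length t)
  Xj-parts = trans (Σℕ-* D g (length t))
    (trans (Σℕ-ext _ _ (λ j → denom-bellStep-Xj Q y0 t M hN j (Hj j)) (length t)) (sym (Σℕ-* (M !) _ (length t))))

denom-β-upTo : ∀ B ys → weight ys ≤ B → Exact β ys
denom-β-upTo B       []       h = refl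
denom-β-upTo zero    (y0 ∷ t) h = subst (λ d → d * ((weight ys !) div d) ≡ weight ys !) (sym denom1)
  (trans (ℕₚ.+-identityʳ _) (n/1≡n (weight ys !)))
  where
  ys = y0 ∷ t
  denom1 : denom₂ ys ≡ 1
  denom1 = denom-resp 2 ys [] (weight0⇒~[] ys (ℕₚ.n≤0⇒n≡0 h))
denom-β-upTo (suc B) (y0 ∷ t) h with weight (y0 ∷ t) ℕₚ.≤? B
... | yes p = denom-β-upTo B (y0 ∷ t) p
... | no np = trans (cong (denom₂ ys *_) β≡step) (trans step-exact (cong _! (sym hN)))
  where
  ys = y0 ∷ t
  hN : weight ys ≡ suc B
  hN = ℕₚ.≤-antisym h (ℕₚ.≰⇒> np)
  H0 : ∀ a → y0 ≡ suc a → Exact β (a ∷ t)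
  H0 a refl = denom-β-upTo B (a ∷ t) (ℕₚ.≤-trans (ℕₚ.n≤1+n _) (ℕₚ.≤-reflexive (ℕₚ.suc-injective (trans (sym (weight-dec₀ a t)) hN))))
  Hj : ∀ j a → get t j ≡ suc a → Exact β (lowerAt j ys)
  Hj j a e = denom-β-upTo B (lowerAt j ys) (ℕₚ.≤-reflexive (ℕₚ.suc-injective (trans (weighted-lowerAt 2 j ys a e) hN)))
  step-exact : denom₂ ys * bellStep β ys ≡ suc B !
  step-exact = denom-bellStep β y0 t B hN H0 Hj
  β≡step : β ys ≡ bellStep β ys
  β≡step = β-unique ys (bellStep β ys) (trans step-exact (cong _! (sym hN)))

denom-β : ∀ ys → Exact β ys
denom-β ys = denom-β-upTo (weight ys) ys ℕₚ.≤-refl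

bellRec : ∀ y0 t → 1 ≤ weight (y0 ∷ t) → β (y0 ∷ t) ≡ bellStep β (y0 ∷ t)
bellRec y0 t h = β-unique (y0 ∷ t) (bellStep β (y0 ∷ t))
  (trans (denom-bellStep β y0 t (weight (y0 ∷ t) ∸ 1) hN (λ a _ → denom-β (a ∷ t)) (λ j a _ → denom-β (lowerAt j (y0 ∷ t))))
         (cong _! (sym hN)))
  where
  hN : weight (y0 ∷ t) ≡ suc (weight (y0 ∷ t) ∸ 1)
  hN = sym (ℕₚ.suc-pred (weight (y0 ∷ t)) {{ℕ.>-nonZero h}})

Σℤ : (ℕ → ℤ) → ℕ → ℤ
Σℤ f zero    = + 0
Σℤ f (suc L) = f 0 ℤ.+ Σℤ (λ i → f (suc i)) L

sumℤ-applyUpTo : ∀ (g : ℕ → ℤ) h n → sumℤ (map g (applyUpTo h n)) ≡ Σℤ (g ∘ h) n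
sumℤ-applyUpTo g h zero    = refl
sumℤ-applyUpTo g h (suc n) = cong (λ z → g (h 0) ℤ.+ z) (sumℤ-applyUpTo g (h ∘ suc) n)

sumℤ-upTo : ∀ (g : ℕ → ℤ) n → sumℤ (map g (upTo n)) ≡ Σℤ g n
sumℤ-upTo g n = sumℤ-applyUpTo g (λ x → x) n

Σℤ-ext : ∀ f g → (∀ i → f i ≡ g i) → ∀ L → Σℤ f L ≡ Σℤ g L
Σℤ-ext f g h zero    = refl
Σℤ-ext f g h (suc L) = cong₂ ℤ._+_ (h 0) (Σℤ-ext _ _ (λ i → h (suc i)) L)

Σℤ-zero : ∀ f L → (∀ i → i < L → f i ≡ + 0) → Σℤ f L ≡ + 0
Σℤ-zero f zero    h = refl
Σℤ-zero f (suc L) h = cong₂ ℤ._+_ (h 0 (s≤s z≤n)) (Σℤ-zero _ L (λ i p → h (suc i) (s≤s p)))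

Σℤ-single : ∀ f L x → x < L → (∀ i → i ≢ x → f i ≡ + 0) → Σℤ f L ≡ f x
Σℤ-single f (suc L) zero    p       h =
  trans (cong (λ z → f 0 ℤ.+ z) (Σℤ-zero _ L (λ i _ → h (suc i) (λ ())))) (ℤₚ.+-identityʳ _)
Σℤ-single f (suc L) (suc x) (s≤s p) h =
  trans (cong (ℤ._+ Σℤ (λ i → f (suc i)) L) (h 0 (λ ())))
        (trans (ℤₚ.+-identityˡ _) (Σℤ-single _ L x p (λ i q → h (suc i) (λ e → q (ℕₚ.suc-injective e)))))

sumℤ-concatMap : ∀ {A B : Set} (f : B → ℤ) (g : A → List B) L →
  sumℤ (map f (concatMap g L)) ≡ sumℤ (map (λ r → sumℤ (map f (g r))) L)
sumℤ-concatMap f g []      = refl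
sumℤ-concatMap f g (x ∷ L) = trans (cong sumℤ (Listₚ.map-++ f (g x) (concat (map g L))))
  (trans (sumℤ-++ (map f (g x)) _) (cong (λ z → sumℤ (map f (g x)) ℤ.+ z) (sumℤ-concatMap f g L)))

sumℤ-filter : ∀ {A : Set} (P : A → Bool) (g : A → ℤ) L →
  sumℤ (map g (filterᵇ P L)) ≡ sumℤ (map (λ x → if P x then g x else + 0) L)
sumℤ-filter P g []      = refl
sumℤ-filter P g (x ∷ L) with P x
... | true  = cong (λ z → g x ℤ.+ z) (sumℤ-filter P g L)
... | false = trans (sumℤ-filter P g L) (sym (ℤₚ.+-identityˡ _))

sumℤ-tuples : ∀ len b (f : List ℕ → ℤ) →
  sumℤ (map f (tuples (suc len) b)) ≡ Σℤ (λ r → sumℤ (map (f ∘ (r ∷_)) (tuples len b))) (suc b)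
sumℤ-tuples len b f = trans (sumℤ-concatMap f (λ r → map (r ∷_) (tuples len b)) (upTo (suc b)))
  (trans (sumℤ-upTo (λ r → sumℤ (map f (map (r ∷_) (tuples len b)))) (suc b)) (Σℤ-ext _ _ (λ r → sumℤ-∘ f (r ∷_) (tuples len b)) (suc b)))

tuples-zero : ∀ len b (f : List ℕ → ℤ) → (∀ rs → length rs ≡ len → f rs ≡ + 0) → sumℤ (map f (tuples len b)) ≡ + 0
tuples-zero zero      b f h = cong (ℤ._+ + 0) (h [] refl)
tuples-zero (suc len) b f h = trans (sumℤ-tuples len b f)
  (Σℤ-zero _ (suc b) (λ r _ → tuples-zero len b (f ∘ (r ∷_)) (λ rs e → h (r ∷ rs) (cong suc e))))

tuples-single : ∀ len b (f : List ℕ → ℤ) rs* → length rs* ≡ len → (∀ j → get rs* j ≤ b) →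
  (∀ rs → length rs ≡ len → rs ≢ rs* → f rs ≡ + 0) → sumℤ (map f (tuples len b)) ≡ f rs*
tuples-single zero      b f []        e hb h = ℤₚ.+-identityʳ _
tuples-single (suc len) b f (x ∷ t*) e hb h = trans (sumℤ-tuples len b f)
  (trans (Σℤ-single _ (suc b) x (s≤s (hb 0)) other-heads)
    (tuples-single len b (f ∘ (x ∷_)) t* (ℕₚ.suc-injective e) (λ j → hb (suc j))
      (λ rs el ne → h (x ∷ rs) (cong suc el) (λ q → ne (Listₚ.∷-injectiveʳ q)))))
  where
  other-heads : ∀ r → r ≢ x → sumℤ (map (f ∘ (r ∷_)) (tuples len b)) ≡ + 0
  other-heads r ne = tuples-zero len b (f ∘ (r ∷_)) (λ rs el → h (r ∷ rs) (cong suc el) (λ q → ne (Listₚ.∷-injectiveˡ q)))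

pad : ℕ → List ℕ → List ℕ
pad zero    ys       = []
pad (suc L) []       = 0 ∷ pad L []
pad (suc L) (y ∷ ys) = y ∷ pad L ys

length-pad : ∀ L ys → length (pad L ys) ≡ L
length-pad zero    ys       = refl
length-pad (suc L) []       = cong suc (length-pad L [])
length-pad (suc L) (y ∷ ys) = cong suc (length-pad L ys)

get-pad-le : ∀ L ys j → get (pad L ys) j ≤ get ys j
get-pad-le zero    ys       j       = z≤n
get-pad-le (suc L) []       zero    = z≤n
get-pad-le (suc L) []       (suc j) = get-pad-le L [] j
get-pad-le (suc L) (y ∷ ys) zero    = ℕₚ.≤-refl
get-pad-le (suc L) (y ∷ ys) (suc j) = get-pad-le L ys j

pad~ : ∀ L ys → (∀ j → L ≤ j → get ys j ≡ 0) → pad L ys ~ ys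
pad~ zero    []       h j       = refl
pad~ zero    (y ∷ ys) h j       = sym (h j z≤n)
pad~ (suc L) []       h zero    = refl
pad~ (suc L) []       h (suc j) = pad~ L [] (λ _ _ → refl) j
pad~ (suc L) (y ∷ ys) h zero    = refl
pad~ (suc L) (y ∷ ys) h (suc j) = pad~ L ys (λ j′ p → h (suc j′) (s≤s p)) j

bellTest : ℕ → ℕ → List ℕ → Bool
bellTest N K ys = (size ys ≡ᵇ K) ∧ (weight ys ≡ᵇ N)

bellTest-sound : ∀ N K ys → bellTest N K ys ≡ true → (size ys ≡ K) × (weight ys ≡ N)
bellTest-sound N K ys h = ᵇ⇒ _ _ (∧-true₁ h) , ᵇ⇒ _ _ (∧-true₂ {size ys ≡ᵇ K} h)

bellTest-complete : ∀ N K ys → size ys ≡ K → weight ys ≡ N → bellTest N K ys ≡ true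
bellTest-complete N K ys a b = ∧-intro (⇒ᵇ _ _ a) (⇒ᵇ _ _ b)

bellTest-false : ∀ N K ys → N < K → bellTest N K ys ≡ false
bellTest-false N K ys lt = not-true λ bc → let (a , b) = bellTest-sound N K ys bc in
  ℕₚ.<⇒≱ lt (subst₂ _≤_ a b (size≤weight ys))

too-heavy : ∀ N K j → 1 ≤ K → 2 * K + j ≤ N → N ≤ K + j → ⊥
too-heavy N K j K≥1 heavy light = ℕₚ.<-irrefl refl (begin-strict
  N              ≤⟨ light ⟩
  K + j          <⟨ ℕₚ.m<m+n (K + j) K≥1 ⟩
  K + j + K      ≡⟨ regroup K j ⟩
  2 * K + j      ≤⟨ heavy ⟩
  N              ∎)
  where
  open ℕₚ.≤-Reasoning
  regroup : ∀ K j → K + j + K ≡ 2 * K + j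
  regroup = ℕ-solve

-- The sum defining B N K (1 ≤ K ≤ N) has a single term at X^ys: the tuple 0 ∷ ys,
-- padded to the common length of the candidate tuples.
module BellSumCoeff (N K : ℕ) (ys : List ℕ) (K≤N : K ≤ N) where

  m : Mono
  m = (+ 0 , ys)

  L = N ∸ K

  admissible : List ℕ → Bool
  admissible rs = (sumℕ rs ≡ᵇ K) ∧ (weighted 1 rs ≡ᵇ N)

  term : List ℕ → ℤ × Mono
  term rs = (+ ((N !) div denom 1 rs) , monoOf rs)

  at : List ℕ → ℤ
  at rs = if admissible rs then contrib m (term rs) else + 0

  coeff-as-tuples : coeff (bellSum N K) m ≡ sumℤ (map at (tuples (suc L) K))
  coeff-as-tuples = trans (coeff-as-sum (bellSum N K) m)
    (trans (sumℤ-∘ (contrib m) term (filterᵇ admissible (tuples (suc L) K))) (sumℤ-filter admissible (contrib m ∘ term) (tuples (suc L) K)))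

  at-zero : ∀ rs → (admissible rs ≡ true → monoOf rs ≃ m → ⊥) → at rs ≡ + 0
  at-zero rs h with admissible rs in p
  ... | false = refl
  ... | true  = contrib-absent _ m (monoOf rs) (h refl)

  match : ∀ rs → length rs ≡ suc L → admissible rs ≡ true → monoOf rs ≃ m →
    Σ (List ℕ) λ t → (rs ≡ 0 ∷ t) × (t ~ ys) × (size ys ≡ K) × (weight ys ≡ N)
  match (r ∷ t) _ p (u , tys) with ℤₚ.+-injective u
  ... | refl = t , refl , tys , trans (sym (sumℕ-resp t ys tys)) (ᵇ⇒ _ _ (∧-true₁ p)) ,
               trans (sym (weighted-resp 2 t ys tys)) (ᵇ⇒ _ _ (∧-true₂ {sumℕ (0 ∷ t) ≡ᵇ K} p))

  absent : bellTest N K ys ≡ false → sumℤ (map at (tuples (suc L) K)) ≡ + 0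
  absent bc = tuples-zero (suc L) K at (λ rs el → at-zero rs (λ p q → let (t , _ , _ , a , b) = match rs el p q in
    false≢true (trans (sym bc) (bellTest-complete N K ys a b))))

  module Present (bc : bellTest N K ys ≡ true) where

    hK : size ys ≡ K
    hK = proj₁ (bellTest-sound N K ys bc)

    hN : weight ys ≡ N
    hN = proj₂ (bellTest-sound N K ys bc)

    -- ys has no exponents beyond position L = N - K, since weight ≥ 2 size + j
    beyond : ∀ j → L ≤ j → get ys j ≡ 0
    beyond j lj with get ys j in g
    ... | zero  = refl
    ... | suc a = ⊥-elim (too-heavy N K j K≥1 heavy (ℕₚ.≤-trans (ℕₚ.≤-reflexive (sym (ℕₚ.m+[n∸m]≡n K≤N))) (ℕₚ.+-monoʳ-≤ K lj)))
      where
      used : 1 ≤ get ys j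
      used = subst (1 ≤_) (sym g) (s≤s z≤n)
      K≥1 : 1 ≤ K
      K≥1 = ℕₚ.≤-trans used (subst (get ys j ≤_) hK (get≤sumℕ ys j))
      heavy : 2 * K + j ≤ N
      heavy = subst₂ (λ x y → 2 * x + j ≤ y) hK hN (2size+j≤weight ys j used)

    pys : pad L ys ~ ys
    pys = pad~ L ys beyond

    rs* = 0 ∷ pad L ys

    bounded : ∀ j → get rs* j ≤ K
    bounded zero    = z≤n
    bounded (suc j) = ℕₚ.≤-trans (get-pad-le L ys j) (subst (get ys j ≤_) hK (get≤sumℕ ys j))

    unique : ∀ rs → length rs ≡ suc L → rs ≢ rs* → at rs ≡ + 0
    unique rs el ne = at-zero rs λ p q → let (t , e , tys , _ , _) = match rs el p q in
      ne (trans e (cong (0 ∷_) (~-eq t (pad L ys) (~-trans {t} {ys} {pad L ys} tys (~-sym {pad L ys} {ys} pys))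
        (trans (ℕₚ.suc-injective (trans (cong length (sym e)) el)) (sym (length-pad L ys))))))

    value : at rs* ≡ + β ys
    value = trans (if-true (bellTest-complete N K (pad L ys) (trans (sumℕ-resp (pad L ys) ys pys) hK)
                                                         (trans (weighted-resp 2 (pad L ys) ys pys) hN)))
      (trans (if-true (eqMono-complete (monoOf rs*) m (refl , pys)))
        (cong +_ (cong₂ _div_ (cong _! (sym hN))
          (trans (ℕₚ.+-identityʳ _) (denom-resp 2 (pad L ys) ys pys)))))

    present : sumℤ (map at (tuples (suc L) K)) ≡ + β ys
    present = trans (tuples-single (suc L) K at rs* (cong suc (length-pad L ys)) bounded unique) value

  coeff-bellSum : coeff (bellSum N K) m ≡ (if bellTest N K ys then + β ys else + 0)
  coeff-bellSum with bellTest N K ys in bc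
  ... | true  = trans coeff-as-tuples (Present.present bc)
  ... | false = trans coeff-as-tuples (absent bc)

open BellSumCoeff using (coeff-bellSum)

coeff-B : ∀ N K ys → coeff (B N K) (+ 0 , ys) ≡ (if bellTest N K ys then + β ys else + 0)
coeff-B zero    zero    ys with eqExp [] ys in q
... | true  = trans (ℤₚ.+-identityʳ _) (trans (cong +_ (sym (β[] ys ys~[]))) (sym (if-true {b = bellTest 0 0 ys} bc)))
  where
  ys~[] : ys ~ []
  ys~[] = ~-sym {[]} {ys} (eqExp-sound [] ys q)
  bc : bellTest 0 0 ys ≡ true
  bc = bellTest-complete 0 0 ys (sumℕ-resp ys [] ys~[]) (weighted-resp 2 ys [] ys~[])
... | false = sym (if-false (not-true λ bc → let (a , _) = bellTest-sound 0 0 ys bc in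
  false≢true (trans (sym q) (eqExp-complete [] ys (~-sym {ys} {[]} (size0⇒~[] ys a))))))
coeff-B (suc N) zero    ys = sym (if-false (not-true λ bc → let (a , b) = bellTest-sound (suc N) 0 ys bc in
  ℕₚ.1+n≢0 (trans (sym b) (weighted-resp 2 ys [] (size0⇒~[] ys a)))))
coeff-B N       (suc K) ys with N <ᵇ suc K in lt
... | true  = trans (cong (λ p → coeff p (+ 0 , ys)) (B-empty N K lt))
                    (sym (if-false (bellTest-false N (suc K) ys (<ᵇ⇒ lt))))
  where
  B-empty : ∀ N K → (N <ᵇ suc K) ≡ true → B N (suc K) ≡ 0P
  B-empty zero    K e = refl
  B-empty (suc N) K e = if-true e
... | false = trans (cong (λ p → coeff p (+ 0 , ys)) (B-sum N K lt))
                    (coeff-bellSum N (suc K) ys (ℕₚ.≮⇒≥ λ p → false≢true (trans (sym lt) (⇒<ᵇ p))))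
  where
  B-sum : ∀ N K → (N <ᵇ suc K) ≡ false → B N (suc K) ≡ bellSum N (suc K)
  B-sum zero    K e = if-false e
  B-sum (suc N) K e = if-false e

sign : ℕ → ℤ
sign K = (ℤ.- + 1) ℤ.^ K

inSupport : ℕ → ℕ → ℤ → List ℕ → Bool
inSupport n k e ys = does (e ℤ.≟ (+ n ℤ.- + 1 ℤ.- + size ys)) ∧ (suc k + weight ys ≡ᵇ n + size ys)

closedForm : ℕ → ℕ → Mono → ℤ
closedForm n       (suc k) (e , ys) =
  if inSupport n k e ys then sign (size ys) ℤ.* + (((n ∸ 1 + size ys) C k) * β ys) else + 0
closedForm zero    zero    m = coeff X₁⁻¹ m
closedForm (suc n) zero    m = + 0

inSupport-sound : ∀ n k e ys → inSupport n k e ys ≡ true →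
  (e ≡ + n ℤ.- + 1 ℤ.- + size ys) × (suc k + weight ys ≡ n + size ys)
inSupport-sound n k e ys h = ℤ≟-sound e _ (∧-true₁ h) , ᵇ⇒ _ _ (∧-true₂ {does (e ℤ.≟ (+ n ℤ.- + 1 ℤ.- + size ys))} h)

inSupport-complete : ∀ n k e ys → e ≡ + n ℤ.- + 1 ℤ.- + size ys → suc k + weight ys ≡ n + size ys → inSupport n k e ys ≡ true
inSupport-complete n k e ys p q = ∧-intro (ℤ≟-complete e _ p) (⇒ᵇ _ _ q)

inSupport-false : ∀ n k e ys → n ≤ k → inSupport n k e ys ≡ false
inSupport-false n k e ys h = not-true λ c →
  ℕₚ.<-irrefl refl (ℕₚ.≤-trans (ℕₚ.≤-trans (ℕₚ.+-monoʳ-≤ (suc k) (size≤weight ys))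
    (ℕₚ.≤-reflexive (proj₂ (inSupport-sound n k e ys c)))) (ℕₚ.+-monoˡ-≤ (size ys) h))

closedForm-vanish : ∀ n k e ys → n ≤ k → closedForm n (suc k) (e , ys) ≡ + 0
closedForm-vanish n k e ys h = if-false (inSupport-false n k e ys h)

rhsCoeff : ℕ → ℕ → ℕ → ℤ
rhsCoeff n k r = sign (n ∸ 1 ∸ r) ℤ.* + ((2 * n ∸ 2 ∸ r) C k)

rhsTerm : ℕ → ℕ → ℕ → Poly
rhsTerm n k r = scale (rhsCoeff n k r) (X₁^ r *P B̃ (2 * n ∸ 1 ∸ suc k ∸ r) (n ∸ 1 ∸ r))

coeff-rhsTerm : ∀ n k r e ys → coeff (rhsTerm n k r) (e , ys) ≡
  (if (does (e ℤ.≟ + r) ∧ bellTest (2 * n ∸ 1 ∸ suc k ∸ r) (n ∸ 1 ∸ r) ys) then rhsCoeff n k r ℤ.* + β ys else + 0)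
coeff-rhsTerm n k r e ys =
  trans (coeff-scale c (X₁^ r *P B̃ N′ K′) (e , ys)) (trans (cong (c ℤ.*_) (coeff-X₁^ r (B̃ N′ K′) e ys)) by-exponent)
  where
  c = rhsCoeff n k r
  N′ = 2 * n ∸ 1 ∸ suc k ∸ r
  K′ = n ∸ 1 ∸ r
  pull-if : ∀ b → c ℤ.* (if b then + β ys else + 0) ≡ (if b then c ℤ.* + β ys else + 0)
  pull-if true  = refl
  pull-if false = ℤₚ.*-zeroʳ c
  by-exponent : c ℤ.* coeff (B̃ N′ K′) (e ℤ.- + r , ys) ≡ (if (does (e ℤ.≟ + r) ∧ bellTest N′ K′ ys) then c ℤ.* + β ys else + 0)
  by-exponent with e ℤ.≟ + r
  ... | yes refl = trans (cong (λ z → c ℤ.* coeff (B̃ N′ K′) (z , ys)) (ℤₚ.+-inverseʳ (+ r)))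
         (trans (cong (c ℤ.*_) (trans (coeff-killX₁-0 (B N′ K′) ys) (coeff-B N′ K′ ys))) (pull-if (bellTest N′ K′ ys)))
  ... | no q = trans (cong (c ℤ.*_) (coeff-killX₁-≠ (B N′ K′) (e ℤ.- + r) ys
                       (λ h → q (trans (add-back e (+ r)) (trans (cong (ℤ._+ + r) h) (ℤₚ.+-identityˡ (+ r)))))))
                     (ℤₚ.*-zeroʳ c)
    where
    add-back : ∀ e r → e ≡ (e ℤ.- r) ℤ.+ r
    add-back = ℤ-solve

∸-≡ : ∀ x y z → x ≡ z + y → x ∸ y ≡ z
∸-≡ x y z e rewrite e = ℕₚ.m+n∸n≡m z y

module RhsIndex (m k i d : ℕ) (hm : (k + i) + d ≡ m) where

  bell-size : suc m ∸ 1 ∸ (k + i) ≡ d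
  bell-size rewrite sym hm = ℕₚ.m+n∸m≡n (k + i) d

  bell-weight : 2 * suc m ∸ 1 ∸ suc k ∸ (k + i) ≡ i + 2 * d
  bell-weight rewrite ℕₚ.∸-+-assoc (2 * suc m ∸ 1) (suc k) (k + i) | ℕₚ.∸-+-assoc (2 * suc m) 1 (suc k + (k + i)) =
    ∸-≡ (2 * suc m) (1 + (suc k + (k + i))) (i + 2 * d) (trans (cong (λ z → 2 * suc z) (sym hm)) (regroup k i d))
    where
    regroup : ∀ k i d → 2 * suc ((k + i) + d) ≡ (i + 2 * d) + (1 + (suc k + (k + i)))
    regroup = ℕ-solve

  binomial-top : 2 * suc m ∸ 2 ∸ (k + i) ≡ m + d
  binomial-top rewrite ℕₚ.∸-+-assoc (2 * suc m) 2 (k + i) =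
    ∸-≡ (2 * suc m) (2 + (k + i)) (m + d)
      (trans (cong (λ z → 2 * suc z) (sym hm)) (trans (regroup k i d) (cong (λ z → (z + d) + (2 + (k + i))) hm)))
    where
    regroup : ∀ k i d → 2 * suc ((k + i) + d) ≡ ((k + i + d) + d) + (2 + (k + i))
    regroup = ℕ-solve

  X₁-exponent : + suc m ℤ.- + 1 ℤ.- + d ≡ + (k + i)
  X₁-exponent rewrite sym hm | ℤₚ.pos-+ 1 ((k + i) + d) | ℤₚ.pos-+ (k + i) d = regroup (+ (k + i)) (+ d)
    where
    regroup : ∀ a b → + 1 ℤ.+ (a ℤ.+ b) ℤ.- + 1 ℤ.- b ≡ a
    regroup = ℤ-solve

  weight-balance : suc k + (i + 2 * d) ≡ suc m + d
  weight-balance rewrite sym hm = regroup k i d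
    where
    regroup : ∀ k i d → suc k + (i + 2 * d) ≡ suc ((k + i) + d) + d
    regroup = ℕ-solve

-- The coefficient of X₁^e X^ys in rhs (m+1) (k+1): at most the summand r = k + i with
-- e = k + i contributes, and it does exactly when X₁^e X^ys is in the support.
module RhsCoeff (m k : ℕ) (e : ℤ) (ys : List ℕ) (hk : k ≤ m) where

  L = suc m ∸ k
  K = size ys
  N = weight ys

  hit : ℕ → Bool
  hit i = does (e ℤ.≟ + (k + i)) ∧ bellTest (2 * suc m ∸ 1 ∸ suc k ∸ (k + i)) (suc m ∸ 1 ∸ (k + i)) ys

  summand : ℕ → ℤ
  summand i = if hit i then rhsCoeff (suc m) k (k + i) ℤ.* + β ys else + 0

  in-range : ∀ i → i < L → k + i ≤ m
  in-range i p = subst (_≤ m) (ℕₚ.+-comm i k)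
    (ℕₚ.≤-pred (ℕₚ.≤-trans (ℕₚ.+-monoˡ-≤ k p) (ℕₚ.≤-reflexive (ℕₚ.m∸n+n≡m (ℕₚ.≤-trans hk (ℕₚ.n≤1+n m))))))

  hit⇒support : ∀ i → i < L → hit i ≡ true → inSupport (suc m) k e ys ≡ true
  hit⇒support i p q = inSupport-complete (suc m) k e ys
    (trans e≡ (sym (trans (cong (λ z → + suc m ℤ.- + 1 ℤ.- + z) K≡) (RhsIndex.X₁-exponent m k i d hd))))
    (trans (cong (suc k ℕ.+_) (trans (proj₂ bc) (RhsIndex.bell-weight m k i d hd)))
           (trans (RhsIndex.weight-balance m k i d hd) (cong (suc m ℕ.+_) (sym K≡))))
    where
    d = proj₁ (ℕₚ.m≤n⇒∃[o]m+o≡n (in-range i p))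
    hd : (k + i) + d ≡ m
    hd = proj₂ (ℕₚ.m≤n⇒∃[o]m+o≡n (in-range i p))
    e≡ : e ≡ + (k + i)
    e≡ = ℤ≟-sound e _ (∧-true₁ q)
    bc = bellTest-sound _ _ ys (∧-true₂ {does (e ℤ.≟ + (k + i))} q)
    K≡ : K ≡ d
    K≡ = trans (proj₁ bc) (RhsIndex.bell-size m k i d hd)

  absent : inSupport (suc m) k e ys ≡ false → Σℤ summand L ≡ + 0
  absent fc = Σℤ-zero summand L vanish
    where
    vanish : ∀ i → i < L → summand i ≡ + 0
    vanish i p with hit i in q
    ... | false = refl
    ... | true  = ⊥-elim (false≢true (trans (sym fc) (hit⇒support i p q)))

  module Present (fc : inSupport (suc m) k e ys ≡ true) where

    he : e ≡ + suc m ℤ.- + 1 ℤ.- + K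
    he = proj₁ (inSupport-sound (suc m) k e ys fc)

    hN : suc k + N ≡ suc m + K
    hN = proj₂ (inSupport-sound (suc m) k e ys fc)

    -- the contributing index i₀ = m - k - K
    k+K≤m : k + K ≤ m
    k+K≤m = ℕₚ.+-cancelʳ-≤ K (k + K) m (ℕₚ.≤-pred (subst₂ _≤_ (regroup k K) hN (ℕₚ.+-monoʳ-≤ (suc k) (2size≤weight ys))))
      where
      regroup : ∀ k K → suc k + 2 * K ≡ suc ((k + K) + K)
      regroup = ℕ-solve

    i₀ = proj₁ (ℕₚ.m≤n⇒∃[o]m+o≡n k+K≤m)

    hd : (k + i₀) + K ≡ m
    hd = trans (regroup k K i₀) (proj₂ (ℕₚ.m≤n⇒∃[o]m+o≡n k+K≤m))
      where
      regroup : ∀ k K i → (k + i) + K ≡ (k + K) + i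
      regroup = ℕ-solve

    e≡ : e ≡ + (k + i₀)
    e≡ = trans he (RhsIndex.X₁-exponent m k i₀ K hd)

    i₀<L : i₀ < L
    i₀<L = ℕₚ.m+n≤o⇒m≤o∸n (suc i₀) (s≤s (subst (_≤ m) (ℕₚ.+-comm k i₀) (ℕₚ.≤-trans (ℕₚ.m≤m+n (k + i₀) K) (ℕₚ.≤-reflexive hd))))

    only-i₀ : ∀ i → i ≢ i₀ → summand i ≡ + 0
    only-i₀ i ne with hit i in q
    ... | false = refl
    ... | true  = ⊥-elim (ne (sym (ℕₚ.+-cancelˡ-≡ k _ _ (ℤₚ.+-injective (trans (sym e≡) (ℤ≟-sound e _ (∧-true₁ q)))))))

    hit-i₀ : hit i₀ ≡ true
    hit-i₀ = ∧-intro (ℤ≟-complete e _ e≡)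
      (bellTest-complete _ _ ys (sym (RhsIndex.bell-size m k i₀ K hd))
        (trans (ℕₚ.+-cancelˡ-≡ (suc k) _ _ (trans hN (sym (RhsIndex.weight-balance m k i₀ K hd))))
               (sym (RhsIndex.bell-weight m k i₀ K hd))))

    value : rhsCoeff (suc m) k (k + i₀) ℤ.* + β ys ≡ sign K ℤ.* + (((suc m ∸ 1 + K) C k) * β ys)
    value rewrite RhsIndex.bell-size m k i₀ K hd | RhsIndex.binomial-top m k i₀ K hd =
      trans (ℤₚ.*-assoc (sign K) (+ ((m + K) C k)) (+ β ys)) (cong (sign K ℤ.*_) (sym (ℤₚ.pos-* ((m + K) C k) (β ys))))

    present : Σℤ summand L ≡ closedForm (suc m) (suc k) (e , ys)
    present = trans (Σℤ-single summand L i₀ i₀<L only-i₀) (trans (if-true hit-i₀) (trans value (sym (if-true fc))))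

  coeff-rhs-sum : ∀ (term : ℕ → Poly) → (∀ r → term r ≡ rhsTerm (suc m) k r) →
    coeff (sumP (map term (map (k ℕ.+_) (upTo L)))) (e , ys) ≡ closedForm (suc m) (suc k) (e , ys)
  coeff-rhs-sum term is-rhsTerm = begin
    coeff (sumP (map term (map (k ℕ.+_) (upTo L)))) (e , ys)   ≡⟨ coeff-sumP (map term (map (k ℕ.+_) (upTo L))) (e , ys) ⟩
    sumℤ (map (λ p → coeff p (e , ys)) (map term (map (k ℕ.+_) (upTo L))))
      ≡⟨ trans (sumℤ-∘ (λ p → coeff p (e , ys)) term (map (k ℕ.+_) (upTo L)))
               (sumℤ-∘ (λ r → coeff (term r) (e , ys)) (k ℕ.+_) (upTo L)) ⟩
    sumℤ (map (λ i → coeff (term (k + i)) (e , ys)) (upTo L)) ≡⟨ sumℤ-upTo (λ i → coeff (term (k + i)) (e , ys)) L ⟩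
    Σℤ (λ i → coeff (term (k + i)) (e , ys)) L
      ≡⟨ Σℤ-ext _ summand (λ i → trans (cong (λ p → coeff p (e , ys)) (is-rhsTerm (k + i))) (coeff-rhsTerm (suc m) k (k + i) e ys)) L ⟩
    Σℤ summand L                                              ≡⟨ by-support _ refl ⟩
    closedForm (suc m) (suc k) (e , ys)                       ∎
    where
    open ≡-Reasoning
    by-support : ∀ b → inSupport (suc m) k e ys ≡ b → Σℤ summand L ≡ closedForm (suc m) (suc k) (e , ys)
    by-support true  fc = Present.present fc
    by-support false fc = trans (absent fc) (sym (if-false fc))

coeff-rhs : ∀ m k e ys → k ≤ m → coeff (rhs (suc m) (suc k)) (e , ys) ≡ closedForm (suc m) (suc k) (e , ys)
coeff-rhs m k e ys hk = RhsCoeff.coeff-rhs-sum m k e ys hk _ (λ r → refl)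

binomial-factorial : ∀ n k → k ≤ n → (k ! * (n ∸ k) !) * (n C k) ≡ n !
binomial-factorial n k h rewrite nCk≡n!/k![n-k]! h = m*[n/m]≡n {{ℕₚ._!*_!≢0 k (n ∸ k)}} (k![n∸k]!∣n! h)

absorption : ∀ M k → M * ((M ∸ 1) C k) ≡ (M ∸ k) * (M C k)
absorption zero    k = trans (ℕₚ.*-zeroˡ ((0 ∸ 1) C k)) (sym (cong (_* (0 C k)) (ℕₚ.0∸n≡0 k)))
absorption (suc L) k with k ℕₚ.≤? L
... | yes k≤L = ℕₚ.*-cancelʳ-≡ _ _ (k ! * (L ∸ k) !) {{ℕₚ._!*_!≢0 k (L ∸ k)}} (trans lhs (sym rhs′))
  where
  suc-∸ : suc L ∸ k ≡ suc (L ∸ k)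
  suc-∸ = ℕₚ.+-∸-assoc 1 k≤L
  lhs : suc L * (L C k) * (k ! * (L ∸ k) !) ≡ suc L !
  lhs = trans (regroup (suc L) (L C k) (k ! * (L ∸ k) !)) (cong (suc L *_) (binomial-factorial L k k≤L))
    where
    regroup : ∀ a b c → a * b * c ≡ a * (c * b)
    regroup = ℕ-solve
  rhs′ : (suc L ∸ k) * (suc L C k) * (k ! * (L ∸ k) !) ≡ suc L !
  rhs′ = trans (cong (λ z → z * (suc L C k) * (k ! * (L ∸ k) !)) suc-∸)
    (trans (regroup (L ∸ k) (suc L C k) (k !) ((L ∸ k) !))
      (subst (λ z → k ! * z ! * (suc L C k) ≡ suc L !) suc-∸ (binomial-factorial (suc L) k (ℕₚ.≤-trans k≤L (ℕₚ.n≤1+n L)))))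
    where
    regroup : ∀ d c f g → suc d * c * (f * g) ≡ f * (g + d * g) * c
    regroup = ℕ-solve
... | no k≰L with k ℕₚ.≟ suc L
...   | yes refl = trans (cong (suc L *_) (k>n⇒nCk≡0 (ℕₚ.n<1+n L)))
                         (trans (ℕₚ.*-zeroʳ (suc L)) (sym (cong (_* (suc L C suc L)) (ℕₚ.n∸n≡0 (suc L)))))
...   | no k≢ = trans (cong (suc L *_) (k>n⇒nCk≡0 (ℕₚ.≰⇒> k≰L)))
                      (trans (ℕₚ.*-zeroʳ (suc L)) (sym (trans (cong ((suc L ∸ k) *_) (k>n⇒nCk≡0 gt)) (ℕₚ.*-zeroʳ (suc L ∸ k)))))
  where
  gt : suc L < k
  gt = ℕₚ.≤∧≢⇒< (ℕₚ.≰⇒> k≰L) (λ e → k≢ (sym e))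

-- C(M, k-1), with the convention C(M, -1) = 0
binom-pred : ℕ → ℕ → ℕ
binom-pred M zero    = 0
binom-pred M (suc k) = M C k

pascal : ∀ M k → suc M C k ≡ M C k + binom-pred M k
pascal M zero    = refl
pascal M (suc k) = trans (sym (nCk+nC[k+1]≡[n+1]C[k+1] M k)) (ℕₚ.+-comm (M C k) (M C suc k))

-- The combinatorial heart of the induction step: absorption, the recurrence of β
-- and Pascal's rule combine the three parts of the recurrence of S.

lowerTerm : List ℕ → ℕ → ℕ
lowerTerm ys j = whenPosℕ (get ys (suc j)) (suc (get ys j) * β (lowerAt j ys))

∸-shift : ∀ M k N → k + N ≡ suc M → M ∸ k ≡ N ∸ 1
∸-shift M k zero    e = subst (λ z → M ∸ z ≡ 0) (sym (trans (sym (ℕₚ.+-identityʳ k)) e)) (ℕₚ.m≤n⇒m∸n≡0 (ℕₚ.n≤1+n M))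
∸-shift M k (suc N) e = ∸-≡ M k N (ℕₚ.suc-injective (trans (sym e) (trans (ℕₚ.+-suc k N) (cong suc (ℕₚ.+-comm k N)))))

-- C(M, k) · bellStep β + C(M, k-1) · β = C(M+1, k) · β; for weight 0 we have M < k, so C(M, k) = 0
bellStep-pascal : ∀ M k y0 t → k + weight (y0 ∷ t) ≡ suc M →
  (M C k) * bellStep β (y0 ∷ t) + binom-pred M k * β (y0 ∷ t) ≡ (suc M C k) * β (y0 ∷ t)
bellStep-pascal M k y0 t e = trans (by-weight (weight (y0 ∷ t)) refl) (cong (_* β (y0 ∷ t)) (sym (pascal M k)))
  where
  by-weight : ∀ N → N ≡ weight (y0 ∷ t) → (M C k) * bellStep β (y0 ∷ t) + binom-pred M k * β (y0 ∷ t)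
                                         ≡ (M C k + binom-pred M k) * β (y0 ∷ t)
  by-weight zero    e0 = trans (cong (λ z → z * bellStep β (y0 ∷ t) + binom-pred M k * β (y0 ∷ t)) (k>n⇒nCk≡0 M<k))
                               (sym (cong (λ z → (z + binom-pred M k) * β (y0 ∷ t)) (k>n⇒nCk≡0 {M} {k} M<k)))
    where
    M<k : M < k
    M<k = ℕₚ.≤-reflexive (sym (trans (sym (ℕₚ.+-identityʳ k)) (trans (cong (k ℕ.+_) e0) e)))
  by-weight (suc N) e0 = trans (cong (λ z → (M C k) * z + binom-pred M k * β (y0 ∷ t)) (sym (bellRec y0 t (subst (1 ≤_) e0 (s≤s z≤n)))))
                               (sym (ℕₚ.*-distribʳ-+ (β (y0 ∷ t)) (M C k) (binom-pred M k)))

core-identity : ∀ M k y0 t → k + weight (y0 ∷ t) ≡ suc M →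
  M * ((M ∸ 1) C k) * whenPosℕ y0 (β (dec 0 (y0 ∷ t))) + binom-pred M k * β (y0 ∷ t) + (M C k) * Σℕ (lowerTerm (y0 ∷ t)) (length t)
  ≡ (suc M C k) * β (y0 ∷ t)
core-identity M k y0 t e = begin
  M * ((M ∸ 1) C k) * b₀ + P * b + (M C k) * Σg
    ≡⟨ cong (λ z → z * b₀ + P * b + (M C k) * Σg) (trans (absorption M k) (cong (_* (M C k)) (∸-shift M k N e))) ⟩
  (N ∸ 1) * (M C k) * b₀ + P * b + (M C k) * Σg
    ≡⟨ regroup (N ∸ 1) (M C k) b₀ (P * b) Σg ⟩
  (M C k) * bellStep β ys + P * b
    ≡⟨ bellStep-pascal M k y0 t e ⟩
  (suc M C k) * b ∎
  where
  open ≡-Reasoning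
  ys = y0 ∷ t
  N = weight ys
  b = β ys
  b₀ = whenPosℕ y0 (β (dec 0 ys))
  P = binom-pred M k
  Σg = Σℕ (lowerTerm ys) (length t)
  regroup : ∀ n c b₀ q s → n * c * b₀ + q + c * s ≡ c * (n * b₀ + s) + q
  regroup = ℕ-solve

-- Each part of the recurrence at
-- X₁^e X^ys is (guarded by the support condition of the target) sign K times a
-- natural number, and core-identity adds these numbers up.

when : Bool → ℤ → ℤ
when b x = if b then x else + 0

when-+ : ∀ b x y → when b x ℤ.+ when b y ≡ when b (x ℤ.+ y)
when-+ true  x y = refl
when-+ false x y = refl

when-0 : ∀ b → when b (+ 0) ≡ + 0
when-0 true  = refl
when-0 false = refl

when-ext : ∀ b x y → (b ≡ true → x ≡ y) → when b x ≡ when b y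
when-ext true  x y h = h refl
when-ext false x y h = refl

when-* : ∀ b (x y : ℤ) → x ℤ.* when b y ≡ when b (x ℤ.* y)
when-* true  x y = refl
when-* false x y = ℤₚ.*-zeroʳ x

Σℤ-when : ∀ b f R → Σℤ (λ j → when b (f j)) R ≡ when b (Σℤ f R)
Σℤ-when true  f R = refl
Σℤ-when false f R = Σℤ-zero _ R (λ _ _ → refl)

Σℤ-pos : ∀ s g R → Σℤ (λ j → s ℤ.* + g j) R ≡ s ℤ.* + Σℕ g R
Σℤ-pos s g zero    = sym (ℤₚ.*-zeroʳ s)
Σℤ-pos s g (suc R) = trans (cong (λ z → s ℤ.* + g 0 ℤ.+ z) (Σℤ-pos s (λ i → g (suc i)) R))
  (trans (sym (ℤₚ.*-distribˡ-+ s (+ g 0) _)) (cong (s ℤ.*_) (sym (ℤₚ.pos-+ (g 0) _))))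

sign-collect : ∀ s a b c → s ℤ.* + a ℤ.+ (s ℤ.* + b ℤ.+ s ℤ.* + c) ≡ s ℤ.* + (a + b + c)
sign-collect s a b c = begin
  s ℤ.* + a ℤ.+ (s ℤ.* + b ℤ.+ s ℤ.* + c)   ≡⟨ cong (λ z → s ℤ.* + a ℤ.+ z) (sym (ℤₚ.*-distribˡ-+ s (+ b) (+ c))) ⟩
  s ℤ.* + a ℤ.+ s ℤ.* (+ b ℤ.+ + c)         ≡⟨ sym (ℤₚ.*-distribˡ-+ s (+ a) (+ b ℤ.+ + c)) ⟩
  s ℤ.* (+ a ℤ.+ (+ b ℤ.+ + c))             ≡⟨ cong (λ z → s ℤ.* (+ a ℤ.+ z)) (sym (ℤₚ.pos-+ b c)) ⟩
  s ℤ.* (+ a ℤ.+ + (b + c))                 ≡⟨ cong (s ℤ.*_) (sym (ℤₚ.pos-+ a (b + c))) ⟩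
  s ℤ.* + (a + (b + c))                     ≡⟨ cong (λ z → s ℤ.* + z) (sym (ℕₚ.+-assoc a b c)) ⟩
  s ℤ.* + (a + b + c)                       ∎
  where open ≡-Reasoning

≡ᵇ-ext : ∀ a b a′ b′ → (a ≡ b → a′ ≡ b′) → (a′ ≡ b′ → a ≡ b) → (a ≡ᵇ b) ≡ (a′ ≡ᵇ b′)
≡ᵇ-ext a b a′ b′ f g = bool-ext (λ h → ⇒ᵇ _ _ (f (ᵇ⇒ _ _ h))) (λ h → ⇒ᵇ _ _ (g (ᵇ⇒ _ _ h)))

ℤ≟-ext : ∀ (x y x′ y′ : ℤ) → (x ≡ y → x′ ≡ y′) → (x′ ≡ y′ → x ≡ y) → does (x ℤ.≟ y) ≡ does (x′ ℤ.≟ y′)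
ℤ≟-ext x y x′ y′ f g = bool-ext (λ h → ℤ≟-complete _ _ (f (ℤ≟-sound _ _ h))) (λ h → ℤ≟-complete _ _ (g (ℤ≟-sound _ _ h)))

-- multiplying by X₁ raises both e and n by one
X₁-condition-shift : ∀ e p K → does ((e ℤ.- + 1) ℤ.≟ (+ suc p ℤ.- + 1 ℤ.- + K)) ≡ does (e ℤ.≟ (+ suc (suc p) ℤ.- + 1 ℤ.- + K))
X₁-condition-shift e p K = ℤ≟-ext _ _ _ _
  (λ h → trans (raise e (+ p) (+ K) h) (cong (λ z → z ℤ.- + 1 ℤ.- + K) (sym (ℤₚ.pos-+ 1 (suc p)))))
  (λ h → lower e (+ p) (+ K) (trans h (cong (λ z → z ℤ.- + 1 ℤ.- + K) (ℤₚ.pos-+ 1 (suc p)))))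
  where
  raise : ∀ e P K → e ℤ.- + 1 ≡ + 1 ℤ.+ P ℤ.- + 1 ℤ.- K → e ≡ + 1 ℤ.+ (+ 1 ℤ.+ P) ℤ.- + 1 ℤ.- K
  raise e P K h = trans (suc-pred e) (trans (cong (ℤ._+ + 1) h) (regroup P K))
    where
    regroup : ∀ P K → (+ 1 ℤ.+ P ℤ.- + 1 ℤ.- K) ℤ.+ + 1 ≡ + 1 ℤ.+ (+ 1 ℤ.+ P) ℤ.- + 1 ℤ.- K
    regroup = ℤ-solve
  lower : ∀ e P K → e ≡ + 1 ℤ.+ (+ 1 ℤ.+ P) ℤ.- + 1 ℤ.- K → e ℤ.- + 1 ≡ + 1 ℤ.+ P ℤ.- + 1 ℤ.- K
  lower e P K h = trans (cong (ℤ._- + 1) h) (regroup P K)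
    where
    regroup : ∀ P K → + 1 ℤ.+ (+ 1 ℤ.+ P) ℤ.- + 1 ℤ.- K ℤ.- + 1 ≡ + 1 ℤ.+ P ℤ.- + 1 ℤ.- K
    regroup = ℤ-solve

-- removing a factor X₂ lowers K by one
X₂-condition-shift : ∀ p K → + suc (suc p) ℤ.- + 1 ℤ.- + suc K ≡ + suc p ℤ.- + 1 ℤ.- + K
X₂-condition-shift p K = trans (cong₂ (λ y z → y ℤ.- + 1 ℤ.- z) (ℤₚ.pos-+ 1 (suc p)) (ℤₚ.pos-+ 1 K)) (regroup (+ suc p) (+ K))
  where
  regroup : ∀ A K → (+ 1 ℤ.+ A) ℤ.- + 1 ℤ.- (+ 1 ℤ.+ K) ≡ A ℤ.- + 1 ℤ.- K
  regroup = ℤ-solve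

inSupport-dec₀ : ∀ p k e a t → inSupport (suc p) k e (a ∷ t) ≡ inSupport (suc (suc p)) k e (suc a ∷ t)
inSupport-dec₀ p k e a t = cong₂ _∧_ (cong (λ z → does (e ℤ.≟ z)) (sym (X₂-condition-shift p K)))
  (≡ᵇ-ext _ _ _ _
    (λ h → trans (cong (suc k ℕ.+_) (weight-dec₀ a t)) (trans (shift k N) (trans (cong (2 ℕ.+_) h) (balance p K))))
    (λ h → ℕₚ.suc-injective (ℕₚ.suc-injective (trans (sym (shift k N))
             (trans (cong (suc k ℕ.+_) (sym (weight-dec₀ a t))) (trans h (sym (balance p K))))))))
  where
  K = size (a ∷ t)
  N = weight (a ∷ t)
  shift : ∀ k n → suc k + (2 + n) ≡ 2 + (suc k + n)
  shift = ℕ-solve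
  balance : ∀ p K → 2 + (suc p + K) ≡ suc (suc p) + suc K
  balance = ℕ-solve

inSupport-lowerAt : ∀ p k e ys j a → get ys (suc j) ≡ suc a →
  inSupport (suc p) k (e ℤ.- + 1) (lowerAt j ys) ≡ inSupport (suc (suc p)) k e ys
inSupport-lowerAt p k e ys j a g = cong₂ _∧_
  (trans (cong (λ z → does ((e ℤ.- + 1) ℤ.≟ (+ suc p ℤ.- + 1 ℤ.- + z))) same-size) (X₁-condition-shift e p (size ys)))
  (≡ᵇ-ext _ _ _ _
    (λ h → trans (cong (suc k ℕ.+_) (sym lighter)) (trans (ℕₚ.+-suc (suc k) _) (cong suc (trans h (cong (suc p ℕ.+_) same-size)))))
    (λ h → trans (ℕₚ.suc-injective (trans (sym (ℕₚ.+-suc (suc k) _)) (trans (cong (suc k ℕ.+_) lighter) h)))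
                 (cong (suc p ℕ.+_) (sym same-size))))
  where
  same-size : size (lowerAt j ys) ≡ size ys
  same-size = size-lowerAt j ys a g
  lighter : suc (weight (lowerAt j ys)) ≡ weight ys
  lighter = weighted-lowerAt 2 j ys a g

step-X₁-part : ∀ p k e ys → closedForm (suc p) k (e ℤ.- + 1 , ys)
  ≡ when (inSupport (suc (suc p)) k e ys) (sign (size ys) ℤ.* + (binom-pred (p + size ys) k * β ys))
step-X₁-part p zero    e ys = sym (trans (cong (when (inSupport (suc (suc p)) 0 e ys)) (ℤₚ.*-zeroʳ (sign (size ys)))) (when-0 _))
step-X₁-part p (suc k) e ys = cong (λ b → when b (sign (size ys) ℤ.* + (((p + size ys) C k) * β ys)))
  (cong (_∧ (suc k + weight ys ≡ᵇ suc p + size ys)) (X₁-condition-shift e p (size ys)))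

pos-regroup : ∀ a s c b → + a ℤ.* (s ℤ.* + (c * b)) ≡ s ℤ.* + (c * (a * b))
pos-regroup a s c b = trans (cong (λ z → + a ℤ.* (s ℤ.* z)) (ℤₚ.pos-* c b)) (trans (regroup (+ a) s (+ c) (+ b))
  (cong (s ℤ.*_) (sym (trans (ℤₚ.pos-* c (a * b)) (cong (+ c ℤ.*_) (ℤₚ.pos-* a b))))))
  where
  regroup : ∀ a s c b → a ℤ.* (s ℤ.* (c ℤ.* b)) ≡ s ℤ.* (c ℤ.* (a ℤ.* b))
  regroup = ℤ-solve

step-deriv-part : ∀ p k e ys j → derivTerm (closedForm (suc p) (suc k)) (e ℤ.- + 1) ys (suc j)
  ≡ when (inSupport (suc (suc p)) k e ys) (sign (size ys) ℤ.* + (((p + size ys) C k) * lowerTerm ys j))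
step-deriv-part p k e ys j with get ys (suc j) in g
... | zero  = sym (trans (cong (when (inSupport (suc (suc p)) k e ys))
                   (trans (cong (λ z → sign (size ys) ℤ.* + z) (ℕₚ.*-zeroʳ ((p + size ys) C k))) (ℤₚ.*-zeroʳ (sign (size ys)))))
                 (when-0 _))
... | suc a = begin
  + suc (get (dec (suc j) ys) j) ℤ.* closedForm (suc p) (suc k) (e ℤ.- + 1 , ys′)
    ≡⟨ cong (λ z → + suc z ℤ.* closedForm (suc p) (suc k) (e ℤ.- + 1 , ys′)) untouched ⟩
  + suc (get ys j) ℤ.* when (inSupport (suc p) k (e ℤ.- + 1) ys′) (sign (size ys′) ℤ.* + (((p + size ys′) C k) * β ys′))
    ≡⟨ when-* (inSupport (suc p) k (e ℤ.- + 1) ys′) (+ suc (get ys j)) _ ⟩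
  when (inSupport (suc p) k (e ℤ.- + 1) ys′) (+ suc (get ys j) ℤ.* (sign (size ys′) ℤ.* + (((p + size ys′) C k) * β ys′)))
    ≡⟨ cong (λ b → when b (+ suc (get ys j) ℤ.* (sign (size ys′) ℤ.* + (((p + size ys′) C k) * β ys′)))) (inSupport-lowerAt p k e ys j a g) ⟩
  when (inSupport (suc (suc p)) k e ys) (+ suc (get ys j) ℤ.* (sign (size ys′) ℤ.* + (((p + size ys′) C k) * β ys′)))
    ≡⟨ cong (λ z → when (inSupport (suc (suc p)) k e ys) (+ suc (get ys j) ℤ.* (sign z ℤ.* + (((p + z) C k) * β ys′)))) (size-lowerAt j ys a g) ⟩
  when (inSupport (suc (suc p)) k e ys) (+ suc (get ys j) ℤ.* (sign (size ys) ℤ.* + (((p + size ys) C k) * β ys′)))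
    ≡⟨ cong (when (inSupport (suc (suc p)) k e ys)) (pos-regroup (suc (get ys j)) (sign (size ys)) ((p + size ys) C k) (β ys′)) ⟩
  when (inSupport (suc (suc p)) k e ys) (sign (size ys) ℤ.* + (((p + size ys) C k) * (suc (get ys j) * β ys′))) ∎
  where
  open ≡-Reasoning
  ys′ = lowerAt j ys
  untouched : get (dec (suc j) ys) j ≡ get ys j
  untouched = trans (get-dec (suc j) ys j) (cong (get ys j ∸_) (ind-neq (suc j) j ℕₚ.1+n≢n))

X₂-coefficient : ∀ p K → κ (suc p) ℤ.+ (+ suc (suc p) ℤ.- + 1 ℤ.- + suc K) ≡ ℤ.- (+ (p + suc K))
X₂-coefficient p K = begin
  ℤ.- (+ (2 * suc p) ℤ.- + 1) ℤ.+ (+ suc (suc p) ℤ.- + 1 ℤ.- + suc K)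
    ≡⟨ cong₂ (λ x y → ℤ.- (x ℤ.- + 1) ℤ.+ (y ℤ.- + 1 ℤ.- + suc K)) two-suc-p suc-suc-p ⟩
  ℤ.- (+ 2 ℤ.* (+ 1 ℤ.+ + p) ℤ.- + 1) ℤ.+ (+ 1 ℤ.+ (+ 1 ℤ.+ + p) ℤ.- + 1 ℤ.- + suc K)
    ≡⟨ cong (λ z → ℤ.- (+ 2 ℤ.* (+ 1 ℤ.+ + p) ℤ.- + 1) ℤ.+ (+ 1 ℤ.+ (+ 1 ℤ.+ + p) ℤ.- + 1 ℤ.- z)) (ℤₚ.pos-+ 1 K) ⟩
  ℤ.- (+ 2 ℤ.* (+ 1 ℤ.+ + p) ℤ.- + 1) ℤ.+ (+ 1 ℤ.+ (+ 1 ℤ.+ + p) ℤ.- + 1 ℤ.- (+ 1 ℤ.+ + K))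
    ≡⟨ regroup (+ p) (+ K) ⟩
  ℤ.- (+ p ℤ.+ (+ 1 ℤ.+ + K))
    ≡⟨ cong ℤ.-_ (sym (trans (ℤₚ.pos-+ p (suc K)) (cong (λ z → + p ℤ.+ z) (ℤₚ.pos-+ 1 K)))) ⟩
  ℤ.- (+ (p + suc K)) ∎
  where
  open ≡-Reasoning
  two-suc-p : + (2 * suc p) ≡ + 2 ℤ.* (+ 1 ℤ.+ + p)
  two-suc-p = trans (ℤₚ.pos-* 2 (suc p)) (cong (+ 2 ℤ.*_) (ℤₚ.pos-+ 1 p))
  suc-suc-p : + suc (suc p) ≡ + 1 ℤ.+ (+ 1 ℤ.+ + p)
  suc-suc-p = trans (ℤₚ.pos-+ 1 (suc p)) (cong (λ z → + 1 ℤ.+ z) (ℤₚ.pos-+ 1 p))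
  regroup : ∀ P K → ℤ.- (+ 2 ℤ.* (+ 1 ℤ.+ P) ℤ.- + 1) ℤ.+ (+ 1 ℤ.+ (+ 1 ℤ.+ P) ℤ.- + 1 ℤ.- (+ 1 ℤ.+ K)) ≡ ℤ.- (P ℤ.+ (+ 1 ℤ.+ K))
  regroup = ℤ-solve

neg-regroup : ∀ m s c b → ℤ.- (+ m) ℤ.* (s ℤ.* + (c * b)) ≡ ((ℤ.- + 1) ℤ.* s) ℤ.* + (m * c * b)
neg-regroup m s c b = trans (cong (λ z → ℤ.- (+ m) ℤ.* (s ℤ.* z)) (ℤₚ.pos-* c b))
  (trans (regroup (+ m) s (+ c) (+ b))
    (cong (((ℤ.- + 1) ℤ.* s) ℤ.*_) (sym (trans (ℤₚ.pos-* (m * c) b) (cong (ℤ._* + b) (ℤₚ.pos-* m c))))))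
  where
  regroup : ∀ m s c b → ℤ.- m ℤ.* (s ℤ.* (c ℤ.* b)) ≡ ((ℤ.- + 1) ℤ.* s) ℤ.* (m ℤ.* c ℤ.* b)
  regroup = ℤ-solve

-- the X₂-term together with X₂ ∂₁: M · C(M-1, k) · β(ys - δ₀)
step-X₂-part : ∀ p k e y0 t →
  κ (suc p) ℤ.* whenPos y0 (closedForm (suc p) (suc k) (e , dec 0 (y0 ∷ t))) ℤ.+ derivTerm (closedForm (suc p) (suc k)) (e ℤ.- + 1) (y0 ∷ t) 0
  ≡ when (inSupport (suc (suc p)) k e (y0 ∷ t))
         (sign (size (y0 ∷ t)) ℤ.* + ((p + size (y0 ∷ t)) * ((p + size (y0 ∷ t) ∸ 1) C k) * whenPosℕ y0 (β (dec 0 (y0 ∷ t)))))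
step-X₂-part p k e zero    t = trans (cong (ℤ._+ + 0) (ℤₚ.*-zeroʳ (κ (suc p))))
  (sym (trans (cong (when (inSupport (suc (suc p)) k e (0 ∷ t)))
    (trans (cong (λ z → sign K ℤ.* + z) (ℕₚ.*-zeroʳ ((p + K) * ((p + K ∸ 1) C k)))) (ℤₚ.*-zeroʳ (sign K)))) (when-0 _)))
  where K = size (0 ∷ t)
step-X₂-part p k e (suc a) t = begin
  κ (suc p) ℤ.* G (e , a ∷ t) ℤ.+ ((e ℤ.- + 1) ℤ.+ + 1) ℤ.* G ((e ℤ.- + 1) ℤ.+ + 1 , a ∷ t)
    ≡⟨ cong (λ z → κ (suc p) ℤ.* G (e , a ∷ t) ℤ.+ z ℤ.* G (z , a ∷ t)) (sym (suc-pred e)) ⟩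
  κ (suc p) ℤ.* G (e , a ∷ t) ℤ.+ e ℤ.* G (e , a ∷ t)
    ≡⟨ sym (ℤₚ.*-distribʳ-+ (G (e , a ∷ t)) (κ (suc p)) e) ⟩
  (κ (suc p) ℤ.+ e) ℤ.* when (inSupport (suc p) k e (a ∷ t)) v
    ≡⟨ when-* (inSupport (suc p) k e (a ∷ t)) (κ (suc p) ℤ.+ e) v ⟩
  when (inSupport (suc p) k e (a ∷ t)) ((κ (suc p) ℤ.+ e) ℤ.* v)
    ≡⟨ cong (λ b → when b ((κ (suc p) ℤ.+ e) ℤ.* v)) (inSupport-dec₀ p k e a t) ⟩
  when (inSupport (suc (suc p)) k e (suc a ∷ t)) ((κ (suc p) ℤ.+ e) ℤ.* v)
    ≡⟨ when-ext _ _ _ value ⟩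
  when (inSupport (suc (suc p)) k e (suc a ∷ t)) (sign (suc K) ℤ.* + ((p + suc K) * ((p + suc K ∸ 1) C k) * β (a ∷ t))) ∎
  where
  open ≡-Reasoning
  G = closedForm (suc p) (suc k)
  K = size (a ∷ t)
  v = sign K ℤ.* + (((p + K) C k) * β (a ∷ t))
  value : inSupport (suc (suc p)) k e (suc a ∷ t) ≡ true →
    (κ (suc p) ℤ.+ e) ℤ.* v ≡ sign (suc K) ℤ.* + ((p + suc K) * ((p + suc K ∸ 1) C k) * β (a ∷ t))
  value c = begin
    (κ (suc p) ℤ.+ e) ℤ.* v
      ≡⟨ cong (λ z → (κ (suc p) ℤ.+ z) ℤ.* v) (proj₁ (inSupport-sound (suc (suc p)) k e (suc a ∷ t) c)) ⟩
    (κ (suc p) ℤ.+ (+ suc (suc p) ℤ.- + 1 ℤ.- + suc K)) ℤ.* v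
      ≡⟨ cong (ℤ._* v) (X₂-coefficient p K) ⟩
    ℤ.- (+ (p + suc K)) ℤ.* v
      ≡⟨ neg-regroup (p + suc K) (sign K) ((p + K) C k) (β (a ∷ t)) ⟩
    sign (suc K) ℤ.* + ((p + suc K) * ((p + K) C k) * β (a ∷ t))
      ≡⟨ cong (λ z → sign (suc K) ℤ.* + ((p + suc K) * (z C k) * β (a ∷ t))) (sym (cong (_∸ 1) (ℕₚ.+-suc p K))) ⟩
    sign (suc K) ℤ.* + ((p + suc K) * ((p + suc K ∸ 1) C k) * β (a ∷ t)) ∎

-- the range of the derivation sum: its first term is the X₂ ∂₁ term
Σℤ-split-first : ∀ p k (f : ℕ → ℤ) → k ≤ suc p → (suc p ≤ k → f 0 ≡ + 0) →
  Σℤ f (suc p ∸ k) ≡ f 0 ℤ.+ Σℤ (λ j → f (suc j)) (p ∸ k)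
Σℤ-split-first p k f hk h0 with k ℕₚ.≤? p
... | yes k≤p = cong (Σℤ f) (ℕₚ.+-∸-assoc 1 k≤p)
... | no k≰p = trans (cong (Σℤ f) (ℕₚ.m≤n⇒m∸n≡0 (ℕₚ.≤-reflexive k≡)))
  (sym (cong₂ ℤ._+_ (h0 (ℕₚ.≤-reflexive k≡)) (cong (Σℤ (λ j → f (suc j))) (ℕₚ.m≤n⇒m∸n≡0 (ℕₚ.≤-trans (ℕₚ.n≤1+n p) (ℕₚ.≤-reflexive k≡))))))
  where
  k≡ : suc p ≡ k
  k≡ = ℕₚ.≤-antisym (ℕₚ.≰⇒> k≰p) hk

-- in the support, X_{j+3} cannot occur for j ≥ p - k, so the derivation sum may be
-- extended to all variables occurring in ys
lowerTerm-vanish : ∀ p k ys j → k + weight ys ≡ suc p + size ys → p ∸ k ≤ j → lowerTerm ys j ≡ 0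
lowerTerm-vanish p k ys j hc hj with get ys (suc j) in g
... | zero  = refl
... | suc a = ⊥-elim (ℕₚ.<⇒≱ (ℕₚ.m+n≤o⇒m≤o∸n (suc j) {k} {p} short) hj)
  where
  K = size ys
  used : 1 ≤ get ys (suc j)
  used = subst (1 ≤_) (sym g) (s≤s z≤n)
  K≥1 : 1 ≤ K
  K≥1 = ℕₚ.≤-trans used (get≤sumℕ ys (suc j))
  regroup : ∀ k K j → k + (2 * K + suc j) ≡ (k + suc j + K) + K
  regroup = ℕ-solve
  bounded : k + suc j + K ≤ suc p
  bounded = ℕₚ.+-cancelʳ-≤ K _ _ (subst₂ _≤_ (regroup k K j) hc (ℕₚ.+-monoʳ-≤ k (2size+j≤weight ys (suc j) used)))
  short : suc j + k ≤ p
  short = ℕₚ.≤-pred (ℕₚ.≤-trans (ℕₚ.≤-reflexive (regroup′ j k)) (ℕₚ.≤-trans (ℕₚ.+-monoʳ-≤ (k + suc j) K≥1) bounded))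
    where
    regroup′ : ∀ j k → suc (suc j + k) ≡ k + suc j + 1
    regroup′ = ℕ-solve

regroup₄ : ∀ a b c d → a ℤ.+ (b ℤ.+ (c ℤ.+ d)) ≡ (a ℤ.+ c) ℤ.+ (b ℤ.+ d)
regroup₄ = ℤ-solve

closedForm-step-∷ : ∀ p k e y0 t → k ≤ suc p →
  recurrence (suc p) k (closedForm (suc p) (suc k)) (closedForm (suc p) k) e (y0 ∷ t) ≡ closedForm (suc (suc p)) (suc k) (e , y0 ∷ t)
closedForm-step-∷ p k e y0 t hk = begin
  A ℤ.+ (X₁-part ℤ.+ sumℤ (map D (upTo (suc p ∸ k))))
    ≡⟨ cong (λ z → A ℤ.+ (X₁-part ℤ.+ z)) (trans (sumℤ-upTo D (suc p ∸ k)) (Σℤ-split-first p k D hk D₀-vanish)) ⟩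
  A ℤ.+ (X₁-part ℤ.+ (D 0 ℤ.+ Σℤ (λ j → D (suc j)) (p ∸ k)))
    ≡⟨ regroup₄ A X₁-part (D 0) _ ⟩
  (A ℤ.+ D 0) ℤ.+ (X₁-part ℤ.+ Σℤ (λ j → D (suc j)) (p ∸ k))
    ≡⟨ cong₂ ℤ._+_ (step-X₂-part p k e y0 t) (cong₂ ℤ._+_ (step-X₁-part p k e ys) deriv-parts) ⟩
  when c (s ℤ.* + a₂) ℤ.+ (when c (s ℤ.* + (P * β ys)) ℤ.+ when c (s ℤ.* + Σℕ (λ j → (M C k) * lowerTerm ys j) (p ∸ k)))
    ≡⟨ trans (cong (λ z → when c (s ℤ.* + a₂) ℤ.+ z) (when-+ c _ _)) (when-+ c _ _) ⟩
  when c (s ℤ.* + a₂ ℤ.+ (s ℤ.* + (P * β ys) ℤ.+ s ℤ.* + Σℕ (λ j → (M C k) * lowerTerm ys j) (p ∸ k)))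
    ≡⟨ when-ext c _ _ in-support ⟩
  when c (s ℤ.* + (((suc (suc p) ∸ 1 + K) C k) * β ys)) ∎
  where
  open ≡-Reasoning
  ys = y0 ∷ t
  G = closedForm (suc p) (suc k)
  K = size ys
  M = p + K
  s = sign K
  P = binom-pred M k
  c = inSupport (suc (suc p)) k e ys
  A = κ (suc p) ℤ.* whenPos y0 (G (e , dec 0 ys))
  X₁-part = closedForm (suc p) k (e ℤ.- + 1 , ys)
  D = derivTerm G (e ℤ.- + 1) ys
  a₂ = M * ((M ∸ 1) C k) * whenPosℕ y0 (β (dec 0 ys))
  D₀-vanish : suc p ≤ k → D 0 ≡ + 0
  D₀-vanish h = trans (cong (λ z → whenPos y0 (((e ℤ.- + 1) ℤ.+ + 1) ℤ.* z)) (closedForm-vanish (suc p) k ((e ℤ.- + 1) ℤ.+ + 1) (dec 0 ys) h))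
                      (trans (cong (whenPos y0) (ℤₚ.*-zeroʳ ((e ℤ.- + 1) ℤ.+ + 1))) (whenPos-0 y0))
  deriv-parts : Σℤ (λ j → D (suc j)) (p ∸ k) ≡ when c (s ℤ.* + Σℕ (λ j → (M C k) * lowerTerm ys j) (p ∸ k))
  deriv-parts = trans (Σℤ-ext _ _ (step-deriv-part p k e ys) (p ∸ k))
    (trans (Σℤ-when c _ (p ∸ k)) (cong (when c) (Σℤ-pos s (λ j → (M C k) * lowerTerm ys j) (p ∸ k))))
  in-support : c ≡ true → s ℤ.* + a₂ ℤ.+ (s ℤ.* + (P * β ys) ℤ.+ s ℤ.* + Σℕ (λ j → (M C k) * lowerTerm ys j) (p ∸ k))
                        ≡ s ℤ.* + (((suc (suc p) ∸ 1 + K) C k) * β ys)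
  in-support hc = trans (sign-collect s _ _ _) (cong (λ z → s ℤ.* + z)
    (trans (cong (λ z → a₂ + P * β ys + z) (trans (sym (Σℕ-* (M C k) (lowerTerm ys) (p ∸ k))) (cong ((M C k) *_) full-range)))
           (core-identity M k y0 t balance)))
    where
    balance : k + weight ys ≡ suc M
    balance = ℕₚ.suc-injective (proj₂ (inSupport-sound (suc (suc p)) k e ys hc))
    R = length t + (p ∸ k)
    full-range : Σℕ (lowerTerm ys) (p ∸ k) ≡ Σℕ (lowerTerm ys) (length t)
    full-range = trans (Σℕ-extend (lowerTerm ys) (p ∸ k) R (ℕₚ.m≤n+m (p ∸ k) (length t)) (λ j h → lowerTerm-vanish p k ys j balance h))
      (sym (Σℕ-extend (lowerTerm ys) (length t) R (ℕₚ.m≤m+n (length t) (p ∸ k))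
        (λ j h → cong (λ z → whenPosℕ z (suc (get ys j) * β (lowerAt j ys))) (get-beyond t j h))))

-- the induction step at a pure power of X₁: only the X₁-part survives
closedForm-step-[] : ∀ p k e → k ≤ suc p →
  recurrence (suc p) k (closedForm (suc p) (suc k)) (closedForm (suc p) k) e [] ≡ closedForm (suc (suc p)) (suc k) (e , [])
closedForm-step-[] p k e hk = begin
  κ (suc p) ℤ.* + 0 ℤ.+ (X₁-part ℤ.+ sumℤ (map (derivTerm G (e ℤ.- + 1) []) (upTo (suc p ∸ k))))
    ≡⟨ cong₂ ℤ._+_ (ℤₚ.*-zeroʳ (κ (suc p))) (cong (λ z → X₁-part ℤ.+ z) no-derivs) ⟩
  + 0 ℤ.+ (X₁-part ℤ.+ + 0)
    ≡⟨ trans (ℤₚ.+-identityˡ _) (ℤₚ.+-identityʳ X₁-part) ⟩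
  X₁-part
    ≡⟨ step-X₁-part p k e [] ⟩
  when (inSupport (suc (suc p)) k e []) (sign 0 ℤ.* + (binom-pred (p + 0) k * 1))
    ≡⟨ when-ext _ _ _ (λ hc → top (k≡ hc)) ⟩
  when (inSupport (suc (suc p)) k e []) (sign 0 ℤ.* + (((suc p + 0) C k) * 1)) ∎
  where
  open ≡-Reasoning
  G = closedForm (suc p) (suc k)
  X₁-part = closedForm (suc p) k (e ℤ.- + 1 , [])
  no-derivs : sumℤ (map (derivTerm G (e ℤ.- + 1) []) (upTo (suc p ∸ k))) ≡ + 0
  no-derivs = sumℤ-zero (derivTerm G (e ℤ.- + 1) []) (λ { zero → refl ; (suc j) → refl }) (upTo (suc p ∸ k))
  k≡ : inSupport (suc (suc p)) k e [] ≡ true → k ≡ suc p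
  k≡ hc = trans (sym (ℕₚ.+-identityʳ k)) (trans (ℕₚ.suc-injective (proj₂ (inSupport-sound (suc (suc p)) k e [] hc))) (ℕₚ.+-identityʳ (suc p)))
  top : ∀ {k} → k ≡ suc p → sign 0 ℤ.* + (binom-pred (p + 0) k * 1) ≡ sign 0 ℤ.* + (((suc p + 0) C k) * 1)
  top refl rewrite ℕₚ.+-identityʳ p | nCn≡1 p | nCn≡1 (suc p) = refl

closedForm-step : ∀ p k e ys → k ≤ suc p →
  recurrence (suc p) k (closedForm (suc p) (suc k)) (closedForm (suc p) k) e ys ≡ closedForm (suc (suc p)) (suc k) (e , ys)
closedForm-step p k e []       hk = closedForm-step-[] p k e hk
closedForm-step p k e (y0 ∷ t) hk = closedForm-step-∷ p k e y0 t hk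

coeff-X₁⁻¹ : ∀ f ys → coeff X₁⁻¹ (f , ys) ≡ (if does (-[1+ 0 ] ℤ.≟ f) ∧ eqExp [] ys then + 1 else + 0) ℤ.+ + 0
coeff-X₁⁻¹ f ys = coeff-cons (+ 1 , (-[1+ 0 ] , [])) [] (f , ys)

support-one : ∀ e ys → inSupport 1 0 e ys ≡ true → (ys ~ []) × (e ≡ + 0)
support-one e ys hc = size0⇒~[] ys K≡0 , trans he (cong (λ x → + 1 ℤ.- + 1 ℤ.- + x) K≡0)
  where
  K = size ys
  he = proj₁ (inSupport-sound 1 0 e ys hc)
  N≡K : weight ys ≡ K
  N≡K = ℕₚ.suc-injective (proj₂ (inSupport-sound 1 0 e ys hc))
  K≡0 : K ≡ 0
  K≡0 = ℕₚ.n≤0⇒n≡0 (ℕₚ.+-cancelˡ-≤ K K 0 (subst (_≤ K + 0) (cong (K ℕ.+_) (ℕₚ.+-identityʳ K))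
          (subst (2 * K ≤_) (trans N≡K (sym (ℕₚ.+-identityʳ K))) (2size≤weight ys))))

closedForm-one : ∀ e ys → coeff X₁⁻¹ (e ℤ.- + 1 , ys) ≡ closedForm 1 1 (e , ys)
closedForm-one e ys = begin
  coeff X₁⁻¹ (e ℤ.- + 1 , ys)                     ≡⟨ trans (coeff-X₁⁻¹ (e ℤ.- + 1) ys) (ℤₚ.+-identityʳ _) ⟩
  (if unit-test then + 1 else + 0)                 ≡⟨ cong (λ b → if b then + 1 else + 0) (sym same-test) ⟩
  when (inSupport 1 0 e ys) (+ 1)                  ≡⟨ when-ext (inSupport 1 0 e ys) _ _ (λ hc → sym (value hc)) ⟩
  closedForm 1 1 (e , ys)                          ∎
  where
  open ≡-Reasoning
  unit-test = does (-[1+ 0 ] ℤ.≟ (e ℤ.- + 1)) ∧ eqExp [] ys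
  e≡0 : -[1+ 0 ] ≡ e ℤ.- + 1 → e ≡ + 0
  e≡0 h = trans (suc-pred e) (cong (ℤ._+ + 1) (sym h))
  same-test : inSupport 1 0 e ys ≡ unit-test
  same-test = bool-ext
    (λ hc → let (ys~[] , e₀) = support-one e ys hc in
      ∧-intro (ℤ≟-complete _ _ (cong (ℤ._- + 1) (sym e₀))) (eqExp-complete [] ys (~-sym {ys} {[]} ys~[])))
    (λ h → let ys~[] : ys ~ []
               ys~[] = ~-sym {[]} {ys} (eqExp-sound [] ys (∧-true₂ {does (-[1+ 0 ] ℤ.≟ (e ℤ.- + 1))} h))
               K≡0 = sumℕ-resp ys [] ys~[]
           in inSupport-complete 1 0 e ys (trans (e≡0 (ℤ≟-sound _ _ (∧-true₁ h))) (cong (λ x → + 1 ℤ.- + 1 ℤ.- + x) (sym K≡0)))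
                                             (cong suc (trans (weighted-resp 2 ys [] ys~[]) (sym K≡0))))
  value : inSupport 1 0 e ys ≡ true → sign (size ys) ℤ.* + (((0 + size ys) C 0) * β ys) ≡ + 1
  value hc = let (ys~[] , _) = support-one e ys hc in
    cong₂ (λ x y → sign x ℤ.* + (((0 + x) C 0) * y)) (sumℕ-resp ys [] ys~[]) (β[] ys ys~[])

S-vanish : ∀ n k → n < k → S (suc n) (suc k) ≡ 0P
S-vanish n k h = if-true (⇒<ᵇ h)

coeffS-step : ∀ p k e ys → (∀ k′ m → coeffS (suc p) k′ m ≡ closedForm (suc p) k′ m) →
  coeffS (suc (suc p)) (suc k) (e , ys) ≡ closedForm (suc (suc p)) (suc k) (e , ys)
coeffS-step p k e ys induction with k ℕₚ.≤? suc p
... | yes k≤ = begin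
  coeffS (suc (suc p)) (suc k) (e , ys)
    ≡⟨ S-step (suc p) k e ys k≤ ⟩
  recurrence (suc p) k (coeffS (suc p) (suc k)) (coeffS (suc p) k) e ys
    ≡⟨ recurrence-ext (suc p) k (induction (suc k)) (induction k) e ys ⟩
  recurrence (suc p) k (closedForm (suc p) (suc k)) (closedForm (suc p) k) e ys
    ≡⟨ closedForm-step p k e ys k≤ ⟩
  closedForm (suc (suc p)) (suc k) (e , ys) ∎
  where open ≡-Reasoning
... | no k≰ = trans (cong (λ q → coeff q (e , ys)) (S-vanish (suc p) k (ℕₚ.≰⇒> k≰)))
                    (sym (closedForm-vanish (suc (suc p)) k e ys (ℕₚ.≰⇒> k≰)))

coeffS-closedForm : ∀ n k e ys → coeffS n k (e , ys) ≡ closedForm n k (e , ys)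
coeffS-closedForm zero          zero          e ys = refl
coeffS-closedForm zero          (suc k)       e ys = sym (closedForm-vanish 0 k e ys z≤n)
coeffS-closedForm (suc n)       zero          e ys = refl
coeffS-closedForm (suc zero)    (suc zero)    e ys = begin
  coeffS 1 1 (e , ys)
    ≡⟨ S-step 0 0 e ys z≤n ⟩
  κ 0 ℤ.* whenPos (get ys 0) (+ 0) ℤ.+ (coeff X₁⁻¹ (e ℤ.- + 1 , ys) ℤ.+ + 0)
    ≡⟨ cong (ℤ._+ (coeff X₁⁻¹ (e ℤ.- + 1 , ys) ℤ.+ + 0)) (trans (cong (κ 0 ℤ.*_) (whenPos-0 (get ys 0))) (ℤₚ.*-zeroʳ (κ 0))) ⟩
  + 0 ℤ.+ (coeff X₁⁻¹ (e ℤ.- + 1 , ys) ℤ.+ + 0)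
    ≡⟨ trans (ℤₚ.+-identityˡ _) (ℤₚ.+-identityʳ _) ⟩
  coeff X₁⁻¹ (e ℤ.- + 1 , ys)
    ≡⟨ closedForm-one e ys ⟩
  closedForm 1 1 (e , ys) ∎
  where open ≡-Reasoning
coeffS-closedForm (suc zero)    (suc (suc k)) e ys =
  trans (cong (λ p → coeff p (e , ys)) (S-vanish 0 (suc k) (s≤s z≤n))) (sym (closedForm-vanish 1 (suc k) e ys (s≤s z≤n)))
coeffS-closedForm (suc (suc p)) (suc k)       e ys =
  coeffS-step p k e ys (λ k′ m → coeffS-closedForm (suc p) k′ (proj₁ m) (proj₂ m))

theorem6p1 : (n k : ℕ) → 1 ≤ k → k ≤ n → S n k ≈ rhs n k
theorem6p1 (suc m) (suc k) _ (s≤s k≤m) (e , ys) = begin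
  coeff (S (suc m) (suc k)) (e , ys)       ≡⟨ coeffS-closedForm (suc m) (suc k) e ys ⟩
  closedForm (suc m) (suc k) (e , ys)      ≡⟨ sym (coeff-rhs m k e ys k≤m) ⟩
  coeff (rhs (suc m) (suc k)) (e , ys)     ∎
  where open ≡-Reasoning
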